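{- Let $s\geq 1$ and $k,r\geq 2$ be integers. Then there exists $n_0(k,s,r)$ such that for all $n>n_0(k,s,r)$ the following holds: for every $r$-uniform hypergraph $\mathcal{H}$ on the vertex set $[n]$ with $\nu(\mathcal{H})<s$ (equivalently, containing no $s$ pairwise disjoint hyperedges), $$\|\mathcal{H}\|_{r-1,k}\leq \Big\|\binom{[n]}{r}-\binom{[s,n]}{r}\Big\|_{r-1,k},$$ so that $\mathrm{ex}_{r-1,k}(n,M_s^r)\le \big\|\binom{[n]}{r}-\binom{[s,n]}{r}\big\|_{r-1,k}$. Moreover, equality holds if and only if $\mathcal{H}$ is the $r$-uniform hypergraph consisting of all $r$-subsets of $[n]$ that intersect a fixed $(s-1)$-subset of $[n]$.
   Context: An $r$-uniform hypergraph ($r$-graph) is identified with its set of hyperedges, each an $r$-subset of the vertex set. $\binom{V}{r}$ is the family of all $r$-subsets of $V$, $[m,n]=\{m,\dots,n\}$, so $\binom{[n]}{r}-\binom{[s,n]}{r}$ is the $r$-graph of all $r$-subsets of $[n]$ meeting $[s-1]$. $\nu(\mathcal{H})$ is the maximum number of pairwise disjoint hyperedges; $M_s^r$ is a matching of $s$ pairwise disjoint hyperedges. For an $(r-1)$-set $T$, $d_{\mathcal{H}}(T)$ is the number of hyperedges of $\mathcal{H}$ containing $T$. The $(r-1,k)$-norm is $\|\mathcal{H}\|_{r-1,k}=\sum_{T\in\binom{V(\mathcal{H})}{r-1}} d_{\mathcal{H}}(T)^k$, and $\mathrm{ex}_{r-1,k}(n,M_s^r)$ is the maximum of $\|\mathcal{H}\|_{r-1,k}$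 over all $n$-vertex $r$-graphs $\mathcal{H}$ not containing $M_s^r$. -}

module Defs where

open import Data.Bool using (Bool; true; false; _∧_; if_then_else_)
open import Data.Nat using (ℕ; zero; suc; _+_; _^_; _∸_; _≡ᵇ_; _<ᵇ_)
open import Data.List using (List; []; _∷_; map; _++_)
open import Data.Nat.ListAction using (sum)
open import Data.Vec using (_∷_; []; tabulate)
open import Data.Fin using (Fin; toℕ)
open import Data.Fin.Subset using (Subset; inside; outside; ∣_∣; _∩_; _⊆_; Empty)
open import Data.Fin.Subset.Properties using (_⊆?_; nonempty?)
open import Data.Product using (Σ; _×_)
open import Relation.Nullary using (¬_)
open import Relation.Nullary.Decidable using (isYes)
open import Relation.Binary.PropositionalEquality using (_≡_; _≢_)

allSubsets : (n : ℕ) → List (Subset n)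
allSubsets zero = [] ∷ []
allSubsets (suc n) = map (outside ∷_) (allSubsets n) ++ map (inside ∷_) (allSubsets n)

Hypergraph : ℕ → Set
Hypergraph n = Subset n → Bool

Uniform : ∀ {n} → ℕ → Hypergraph n → Set
Uniform {n} r H = ∀ (S : Subset n) → H S ≡ true → ∣ S ∣ ≡ r

HasMatching : ∀ {n} → ℕ → Hypergraph n → Set
HasMatching {n} s H =
  Σ (Fin s → Subset n) λ M →
    (∀ i → H (M i) ≡ true) × (∀ i j → i ≢ j → Empty (M i ∩ M j))

degree : ∀ {n} → Hypergraph n → Subset n → ℕ
degree {n} H T = sum (map (λ S → if H S ∧ isYes (T ⊆? S) then 1 else 0) (allSubsets n))

norm : ∀ {n} → ℕ → ℕ → Hypergraph n → ℕ
norm {n} r k H =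
  sum (map (λ T → if ∣ T ∣ ≡ᵇ (r ∸ 1) then degree H T ^ k else 0) (allSubsets n))

star : ∀ {n} → ℕ → Subset n → Hypergraph n
star r A S = (∣ S ∣ ≡ᵇ r) ∧ isYes (nonempty? (S ∩ A))

-- The set [s-1] = {1,…,s-1} (as Fin-indices 0,…,s-2).
initSeg : ∀ {n} → ℕ → Subset n
initSeg s = tabulate (λ i → if toℕ i <ᵇ (s ∸ 1) then inside else outside)

-- Let Q = C(n-2, r-2), which bounds the number of edges through two given vertices, and let A
-- be the set of vertices of degree greater than L = r s Q. Such vertices can be added one at a
-- time to a matching, so |A| < s. The edges H′ of H missing A have a maximal matching with fewer
-- than s - |A| edges; its at most r s vertices meet every edge of H′ and have degree at most L,
-- so |H′| ≤ r s L. An edge through an (r-1)-set T lies in the star of A or in H′, and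
-- d_H(T) ≤ D = n - r + 1; hence ‖H‖ ≤ ‖star A‖ + k D^(k-1) r |H′|. If |A| = s - 1, the
-- maximal matching is empty, so H lies inside the star of A, and the norms agree only if H is
-- that star. If |A| < s - 1, adding a vertex b to A raises the degree of each of the
-- C(n-1-|A|, r-2) ≥ 2^(-s) Q sets T through b avoiding A from |A| to D, and for large n this gain
-- exceeds the error term. The norm of a star only depends on the size of its centre.

module Submission where

open import Defs
import Algebra.Lattice.Properties.BooleanAlgebra as BA
open import Data.Bool using (Bool; true; false; _∧_; not; if_then_else_)
open import Data.Bool.Properties using (∧-zeroʳ; ∧-identityʳ; ∧-comm; ∧-conicalˡ; ∧-conicalʳ)
open import Data.Fin using (Fin; inject≤) renaming (zero to fzero; suc to fsuc)
open import Data.Fin.Properties using (inject≤-injective)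
open import Data.Fin.Subset
open import Data.Fin.Subset.Properties
open import Data.List using (List; []; _∷_; map; _++_)
open import Data.List.Properties using (map-++; map-∘)
open import Data.List.Membership.Propositional using () renaming (_∈_ to _∈ˡ_)
open import Data.List.Membership.Propositional.Properties using (∈-map⁺; ∈-++⁺ˡ; ∈-++⁺ʳ)
open import Data.List.Relation.Unary.Any using () renaming (here to here≡; there to there≡)
open import Data.Nat using (ℕ; zero; suc; _+_; _*_; _∸_; _^_; _≤_; _<_; z≤n; s≤s; _≡ᵇ_; _≤?_; _<?_; _≟_; >-nonZero)
open import Data.Nat.Properties
open import Data.Nat.Combinatorics using (_C_; nC1≡n; nCk≡nC[n∸k]; k>n⇒nCk≡0; nCk+nC[k+1]≡[n+1]C[k+1])
open import Data.Nat.ListAction using (sum)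
open import Data.Nat.ListAction.Properties using (sum-++)
open import Data.Nat.Solver using (module +-*-Solver)
open +-*-Solver using (solve; _:+_; _:*_; _:=_; con)
open import Algebra.Properties.CommutativeSemigroup +-commutativeSemigroup using (interchange)
open import Algebra.Properties.CommutativeSemigroup *-commutativeSemigroup using (x∙yz≈y∙xz)
import Algebra.Properties.Semiring.Sum +-*-semiring as VertexSum
open VertexSum using (sum-syntax)
open import Data.Product using (Σ; _×_; _,_; ∃; ∃₂; proj₁; proj₂)
open import Data.Sum using (inj₁; inj₂)
open import Data.Vec using ([]; _∷_; here; there; tabulate)
open import Data.Vec.Functional using () renaming (_∷_ to _∷ᶠ_)
open import Data.Vec.Properties using (lookup∘tabulate; []=⇒lookup; lookup⇒[]=)
open import Function using (_∘_)
open import Function.Bundles using (_⇔_; mk⇔)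
open import Relation.Binary.PropositionalEquality
open import Relation.Nullary using (¬_; Dec; yes; no; does; contradiction)
open import Relation.Nullary.Decidable using (isYes; isYes≗does; dec-true; dec-false)

𝟙 : Bool → ℕ
𝟙 b = if b then 1 else 0

𝟙-∧ : ∀ a b → 𝟙 (a ∧ b) ≡ 𝟙 a * 𝟙 b
𝟙-∧ true  b = sym (+-identityʳ (𝟙 b))
𝟙-∧ false b = refl

≡ᵇ-refl : ∀ m → (m ≡ᵇ m) ≡ true
≡ᵇ-refl zero    = refl
≡ᵇ-refl (suc m) = ≡ᵇ-refl m

≡ᵇ-true⇒≡ : ∀ m n → (m ≡ᵇ n) ≡ true → m ≡ n
≡ᵇ-true⇒≡ zero    zero    _  = refl
≡ᵇ-true⇒≡ (suc m) (suc n) eq = cong suc (≡ᵇ-true⇒≡ m n eq)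

≡ᵇ-false : ∀ m n → m ≢ n → (m ≡ᵇ n) ≡ false
≡ᵇ-false zero    zero    m≢n = contradiction refl m≢n
≡ᵇ-false zero    (suc n) _   = refl
≡ᵇ-false (suc m) zero    _   = refl
≡ᵇ-false (suc m) (suc n) m≢n = ≡ᵇ-false m n (m≢n ∘ cong suc)

𝟙-∧-mono : ∀ {a b} c → (a ≡ true → b ≡ true) → 𝟙 (a ∧ c) ≤ 𝟙 (b ∧ c)
𝟙-∧-mono {false} c _   = z≤n
𝟙-∧-mono {true}  c a⇒b rewrite a⇒b refl = ≤-refl

𝟙-∧-< : ∀ {a b c} → a ≡ false → b ≡ true → c ≡ true → 𝟙 (a ∧ c) < 𝟙 (b ∧ c)
𝟙-∧-< refl refl refl = s≤s z≤n

if-0-mono : ∀ b {x y} → x ≤ y → (if b then x else 0) ≤ (if b then y else 0)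
if-0-mono true  x≤y = x≤y
if-0-mono false _   = z≤n

if-𝟙 : ∀ b x → (if b then x else 0) ≡ 𝟙 b * x
if-𝟙 true  x = sym (+-identityʳ x)
if-𝟙 false x = refl

𝟙-split : ∀ a b → 𝟙 a ≡ 𝟙 (a ∧ not b) + 𝟙 (a ∧ b)
𝟙-split true  true  = refl
𝟙-split true  false = refl
𝟙-split false b     = refl

does-≡ : ∀ {A B : Set} (a? : Dec A) (b? : Dec B) → (A → B) → (B → A) → does a? ≡ does b?
does-≡ (yes a) (yes b) _   _   = refl
does-≡ (no ¬a) (no ¬b) _   _   = refl
does-≡ (yes a) (no ¬b) a→b _   = contradiction (a→b a) ¬b
does-≡ (no ¬a) (yes b) _   b→a = contradiction (b→a b) ¬a

does-true⇒ : ∀ {A : Set} (a? : Dec A) → does a? ≡ true → A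
does-true⇒ (yes a) _ = a

-- Binomial coefficients

pascal : ∀ n k → suc n C suc k ≡ n C k + n C suc k
pascal n k = sym (nCk+nC[k+1]≡[n+1]C[k+1] n k)

nCk>0 : ∀ {n k} → k ≤ n → 0 < n C k
nCk>0 {n}     {zero}  _         = s≤s z≤n
nCk>0 {suc n} {suc k} (s≤s k≤n) = <-≤-trans (nCk>0 k≤n) (≤-trans (m≤m+n _ _) (≤-reflexive (sym (pascal n k))))

nCk≤[1+n]Ck : ∀ n k → n C k ≤ suc n C k
nCk≤[1+n]Ck n zero    = ≤-refl
nCk≤[1+n]Ck n (suc k) = ≤-trans (m≤n+m _ _) (≤-reflexive (sym (pascal n k)))

nCk-monoˡ : ∀ {m n} k → m ≤ n → m C k ≤ n C k
nCk-monoˡ {n = zero}  k z≤n    = ≤-refl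
nCk-monoˡ {n = suc n} k m≤1+n with m≤n⇒m<n∨m≡n m≤1+n
... | inj₁ m<1+n = ≤-trans (nCk-monoˡ k (≤-pred m<1+n)) (nCk≤[1+n]Ck n k)
... | inj₂ refl  = ≤-refl

[1+k]*[1+n]C[1+k] : ∀ n k → suc k * (suc n C suc k) ≡ suc n * (n C k)
[1+k]*[1+n]C[1+k] zero    zero    = refl
[1+k]*[1+n]C[1+k] zero    (suc k) =
  trans (cong (suc (suc k) *_) (k>n⇒nCk≡0 {1} {suc (suc k)} (s≤s (s≤s z≤n)))) (*-zeroʳ (suc (suc k)))
[1+k]*[1+n]C[1+k] (suc n) zero    = trans (+-identityʳ _) (trans (nC1≡n (suc (suc n))) (sym (*-identityʳ _)))
[1+k]*[1+n]C[1+k] (suc n) (suc k) = begin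
  suc K * (suc N C suc K)
    ≡⟨ cong (suc K *_) (pascal N K) ⟩
  suc K * (X + N C suc K)
    ≡⟨ *-distribˡ-+ (suc K) X _ ⟩
  suc K * X + suc K * (N C suc K)
    ≡⟨ cong (suc K * X +_) ([1+k]*[1+n]C[1+k] n K) ⟩
  (X + K * X) + N * (n C K)
    ≡⟨ cong (λ y → (X + y) + N * (n C K)) ([1+k]*[1+n]C[1+k] n k) ⟩
  (X + N * (n C k)) + N * (n C K)
    ≡⟨ +-assoc X _ _ ⟩
  X + (N * (n C k) + N * (n C K))
    ≡⟨ cong (X +_) (*-distribˡ-+ N (n C k) _) ⟨
  X + N * (n C k + n C K)
    ≡⟨ cong (λ y → X + N * y) (pascal n k) ⟨
  suc N * X ∎
  where
  open ≡-Reasoning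
  N K X : ℕ
  N = suc n
  K = suc k
  X = N C K

nCk≤nC[1+k] : ∀ n k → 2 * suc k ≤ suc n → n C k ≤ n C suc k
nCk≤nC[1+k] n k 2[1+k]≤1+n = *-cancelʳ-≤ a b (suc k) (+-cancelˡ-≤ (a * suc k) _ _ (begin
  a * suc k + a * suc k   ≡⟨ solve 2 (λ a k → a :* k :+ a :* k := (con 2 :* k) :* a) refl a (suc k) ⟩
  (2 * suc k) * a         ≤⟨ *-monoˡ-≤ a 2[1+k]≤1+n ⟩
  suc n * a               ≡⟨ [1+k]*[1+n]C[1+k] n k ⟨
  suc k * (suc n C suc k) ≡⟨ cong (suc k *_) (pascal n k) ⟩
  suc k * (a + b)         ≡⟨ *-comm (suc k) (a + b) ⟩
  (a + b) * suc k         ≡⟨ *-distribʳ-+ (suc k) a b ⟩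
  a * suc k + b * suc k   ∎))
  where
  open ≤-Reasoning
  a b : ℕ
  a = n C k
  b = n C suc k

[1+n]Ck≤2*nCk : ∀ n k → 2 * k ≤ suc n → suc n C k ≤ 2 * (n C k)
[1+n]Ck≤2*nCk n zero    _  = s≤s z≤n
[1+n]Ck≤2*nCk n (suc k) le = begin
  suc n C suc k         ≡⟨ pascal n k ⟩
  n C k + n C suc k     ≤⟨ +-monoˡ-≤ (n C suc k) (nCk≤nC[1+k] n k le) ⟩
  n C suc k + n C suc k ≡⟨ cong (n C suc k +_) (+-identityʳ _) ⟨
  2 * (n C suc k)       ∎
  where open ≤-Reasoning

[j+n]Ck≤2^j*nCk : ∀ n j k → 2 * k ≤ suc n → (j + n) C k ≤ 2 ^ j * (n C k)
[j+n]Ck≤2^j*nCk n zero    k le = ≤-reflexive (sym (+-identityʳ _))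
[j+n]Ck≤2^j*nCk n (suc j) k le = begin
  suc (j + n) C k       ≤⟨ [1+n]Ck≤2*nCk (j + n) k (≤-trans le (s≤s (m≤n+m n j))) ⟩
  2 * ((j + n) C k)     ≤⟨ *-monoʳ-≤ 2 ([j+n]Ck≤2^j*nCk n j k le) ⟩
  2 * (2 ^ j * (n C k)) ≡⟨ *-assoc 2 (2 ^ j) (n C k) ⟨
  2 ^ suc j * (n C k)   ∎
  where open ≤-Reasoning

[x+z]^[1+k]≤x^[1+k]+z*[1+k]*[x+z]^k : ∀ k x z → (x + z) ^ suc k ≤ x ^ suc k + z * (suc k * (x + z) ^ k)
[x+z]^[1+k]≤x^[1+k]+z*[1+k]*[x+z]^k zero x z =
  ≤-reflexive (solve 2 (λ x z → (x :+ z) :* con 1 := x :* con 1 :+ z :* (con 1 :* con 1)) refl x z)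
[x+z]^[1+k]≤x^[1+k]+z*[1+k]*[x+z]^k (suc k) x z = begin
  (x + z) * (x + z) ^ suc k
    ≤⟨ *-monoʳ-≤ (x + z) ([x+z]^[1+k]≤x^[1+k]+z*[1+k]*[x+z]^k k x z) ⟩
  (x + z) * (x ^ suc k + z * (suc k * W))
    ≡⟨ solve 5 (λ x z X W k → (x :+ z) :* (X :+ z :* ((con 1 :+ k) :* W))
                            := x :* X :+ (z :* X :+ z :* ((con 1 :+ k) :* ((x :+ z) :* W))))
             refl x z (x ^ suc k) W k ⟩
  x * x ^ suc k + (z * x ^ suc k + z * (suc k * ((x + z) * W)))
    ≤⟨ +-monoʳ-≤ (x * x ^ suc k) (+-monoˡ-≤ _ (*-monoʳ-≤ z (^-monoˡ-≤ (suc k) (m≤m+n x z)))) ⟩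
  x * x ^ suc k + (z * ((x + z) * W) + z * (suc k * ((x + z) * W)))
    ≡⟨ cong (x * x ^ suc k +_) (solve 3 (λ z V k → z :* V :+ z :* ((con 1 :+ k) :* V)
                                                := z :* ((con 2 :+ k) :* V)) refl z ((x + z) * W) k) ⟩
  x * x ^ suc k + z * (suc (suc k) * ((x + z) * W)) ∎
  where
  open ≤-Reasoning
  W : ℕ
  W = (x + z) ^ k

h^[1+k]≤x^[1+k]+y*[1+k]*D^k : ∀ k {h x y D} → h ≤ x + y → h ≤ D → h ^ suc k ≤ x ^ suc k + y * (suc k * D ^ k)
h^[1+k]≤x^[1+k]+y*[1+k]*D^k k {h} {x} {y} {D} h≤x+y h≤D with h ≤? x
... | yes h≤x = ≤-trans (^-monoˡ-≤ (suc k) h≤x) (m≤m+n _ _)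
... | no  h≰x = begin
  h ^ suc k                             ≡⟨ cong (_^ suc k) x+z≡h ⟨
  (x + z) ^ suc k                       ≤⟨ [x+z]^[1+k]≤x^[1+k]+z*[1+k]*[x+z]^k k x z ⟩
  x ^ suc k + z * (suc k * (x + z) ^ k)
    ≤⟨ +-monoʳ-≤ (x ^ suc k) (*-mono-≤ z≤y (*-monoʳ-≤ (suc k) (^-monoˡ-≤ k x+z≤D))) ⟩
  x ^ suc k + y * (suc k * D ^ k)       ∎
  where
  open ≤-Reasoning
  z : ℕ
  z = h ∸ x
  x+z≡h : x + z ≡ h
  x+z≡h = m+[n∸m]≡n (<⇒≤ (≰⇒> h≰x))
  z≤y : z ≤ y
  z≤y = subst (z ≤_) (m+n∸m≡n x y) (∸-monoˡ-≤ x h≤x+y)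
  x+z≤D : x + z ≤ D
  x+z≤D = subst (_≤ D) (sym x+z≡h) h≤D

-- Sums over all subsets

∑ˢ : ∀ n → (Subset n → ℕ) → ℕ
∑ˢ zero    f = f []
∑ˢ (suc n) f = ∑ˢ n (λ S → f (outside ∷ S)) + ∑ˢ n (λ S → f (inside ∷ S))

sum-map-allSubsets : ∀ n (f : Subset n → ℕ) → sum (map f (allSubsets n)) ≡ ∑ˢ n f
sum-map-allSubsets zero    f = +-identityʳ (f [])
sum-map-allSubsets (suc n) f = begin
  sum (map f (map (outside ∷_) xs ++ map (inside ∷_) xs))
    ≡⟨ cong sum (map-++ f (map (outside ∷_) xs) _) ⟩
  sum (map f (map (outside ∷_) xs) ++ map f (map (inside ∷_) xs))
    ≡⟨ sum-++ (map f (map (outside ∷_) xs)) _ ⟩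
  sum (map f (map (outside ∷_) xs)) + sum (map f (map (inside ∷_) xs))
    ≡⟨ cong₂ _+_ (cong sum (sym (map-∘ xs))) (cong sum (sym (map-∘ xs))) ⟩
  sum (map (λ S → f (outside ∷ S)) xs) + sum (map (λ S → f (inside ∷ S)) xs)
    ≡⟨ cong₂ _+_ (sum-map-allSubsets n _) (sum-map-allSubsets n _) ⟩
  ∑ˢ (suc n) f ∎
  where
  open ≡-Reasoning
  xs : List (Subset n)
  xs = allSubsets n

∑ˢ-cong : ∀ n {f g : Subset n → ℕ} → (∀ S → f S ≡ g S) → ∑ˢ n f ≡ ∑ˢ n g
∑ˢ-cong zero    f≗g = f≗g []
∑ˢ-cong (suc n) f≗g = cong₂ _+_ (∑ˢ-cong n (f≗g ∘ (outside ∷_))) (∑ˢ-cong n (f≗g ∘ (inside ∷_)))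

∑ˢ-mono : ∀ n {f g : Subset n → ℕ} → (∀ S → f S ≤ g S) → ∑ˢ n f ≤ ∑ˢ n g
∑ˢ-mono zero    f≤g = f≤g []
∑ˢ-mono (suc n) f≤g = +-mono-≤ (∑ˢ-mono n (f≤g ∘ (outside ∷_))) (∑ˢ-mono n (f≤g ∘ (inside ∷_)))

∑ˢ-zero : ∀ n → ∑ˢ n (λ _ → 0) ≡ 0
∑ˢ-zero zero    = refl
∑ˢ-zero (suc n) = cong₂ _+_ (∑ˢ-zero n) (∑ˢ-zero n)

∑ˢ-distrib-+ : ∀ n (f g : Subset n → ℕ) → ∑ˢ n (λ S → f S + g S) ≡ ∑ˢ n f + ∑ˢ n g
∑ˢ-distrib-+ zero    f g = refl
∑ˢ-distrib-+ (suc n) f g =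
  trans (cong₂ _+_ (∑ˢ-distrib-+ n (f ∘ (outside ∷_)) (g ∘ (outside ∷_)))
                   (∑ˢ-distrib-+ n (f ∘ (inside ∷_)) (g ∘ (inside ∷_))))
        (interchange (∑ˢ n (f ∘ (outside ∷_))) (∑ˢ n (g ∘ (outside ∷_)))
                     (∑ˢ n (f ∘ (inside ∷_))) (∑ˢ n (g ∘ (inside ∷_))))

*-distribˡ-∑ˢ : ∀ n c (f : Subset n → ℕ) → c * ∑ˢ n f ≡ ∑ˢ n (λ S → c * f S)
*-distribˡ-∑ˢ zero    c f = refl
*-distribˡ-∑ˢ (suc n) c f =
  trans (*-distribˡ-+ c _ _) (cong₂ _+_ (*-distribˡ-∑ˢ n c _) (*-distribˡ-∑ˢ n c _))

∑ˢ-comm : ∀ n m (f : Subset n → Subset m → ℕ) →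
          ∑ˢ n (λ S → ∑ˢ m (f S)) ≡ ∑ˢ m (λ T → ∑ˢ n (λ S → f S T))
∑ˢ-comm zero    m f = refl
∑ˢ-comm (suc n) m f =
  trans (cong₂ _+_ (∑ˢ-comm n m _) (∑ˢ-comm n m _)) (sym (∑ˢ-distrib-+ m _ _))

term≤∑ˢ : ∀ {n} (f : Subset n → ℕ) S → f S ≤ ∑ˢ n f
term≤∑ˢ f []            = ≤-refl
term≤∑ˢ f (outside ∷ S) = ≤-trans (term≤∑ˢ (f ∘ (outside ∷_)) S) (m≤m+n _ _)
term≤∑ˢ f (inside  ∷ S) = ≤-trans (term≤∑ˢ (f ∘ (inside ∷_)) S) (m≤n+m _ _)

∑ˢ-mono-< : ∀ {n} {f g : Subset n → ℕ} → (∀ S → f S ≤ g S) → ∀ S → f S < g S → ∑ˢ n f < ∑ˢ n g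
∑ˢ-mono-< f≤g []            f<g = f<g
∑ˢ-mono-< {suc n} f≤g (outside ∷ S) f<g =
  +-mono-<-≤ (∑ˢ-mono-< (f≤g ∘ (outside ∷_)) S f<g) (∑ˢ-mono n (f≤g ∘ (inside ∷_)))
∑ˢ-mono-< {suc n} f≤g (inside  ∷ S) f<g =
  +-mono-≤-< (∑ˢ-mono n (f≤g ∘ (outside ∷_))) (∑ˢ-mono-< (f≤g ∘ (inside ∷_)) S f<g)

∑ˢ-positive : ∀ n (f : Subset n → ℕ) → 0 < ∑ˢ n f → ∃ λ S → 0 < f S
∑ˢ-positive zero    f 0<f = [] , 0<f
∑ˢ-positive (suc n) f 0<∑ with ∑ˢ n (f ∘ (outside ∷_)) in eq
... | suc _ = let S , 0<fS = ∑ˢ-positive n _ (subst (0 <_) (sym eq) (s≤s z≤n)) in outside ∷ S , 0<fS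
... | zero  = let S , 0<fS = ∑ˢ-positive n _ 0<∑ in inside ∷ S , 0<fS

module _ {n : ℕ} where

  infix 7 _∈ᵇ_ _⊆ᵇ_

  _∈ᵇ_ : Fin n → Subset n → Bool
  x ∈ᵇ S = does (x ∈? S)

  _⊆ᵇ_ : Subset n → Subset n → Bool
  T ⊆ᵇ S = does (T ⊆? S)

  -- S meets A iff not (S ⊆ᵇ ∁ A), a test that, unlike nonempty?, computes on vector heads.
  isYes-nonempty?-∩ : ∀ (S A : Subset n) → isYes (nonempty? (S ∩ A)) ≡ not (S ⊆ᵇ ∁ A)
  isYes-nonempty?-∩ S A with nonempty? (S ∩ A) | S ⊆? ∁ A
  ... | yes _ | no _ = refl
  ... | no _  | yes _ = refl
  ... | yes (x , x∈S∩A) | yes S⊆∁A =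
    let x∈S , x∈A = x∈p∩q⁻ S A x∈S∩A in contradiction x∈A (x∈∁p⇒x∉p (S⊆∁A x∈S))
  ... | no S∩A-empty | no S⊈∁A =
    contradiction (λ {x} x∈S → x∉p⇒x∈∁p (λ x∈A → S∩A-empty (x , x∈p∩q⁺ (x∈S , x∈A)))) S⊈∁A

⊥⊆ᵇ : ∀ {n} (T : Subset n) → ⊥ ⊆ᵇ T ≡ true
⊥⊆ᵇ T = dec-true (⊥ ⊆? T) ⊥⊆

⊆ᵇ∁⊥ : ∀ {n} (T : Subset n) → T ⊆ᵇ ∁ ⊥ ≡ true
⊆ᵇ∁⊥ T = dec-true (T ⊆? ∁ ⊥) (λ _ → x∉p⇒x∈∁p ∉⊥)

p⊆∁q⇒∣p∣+∣q∣≤n : ∀ {n} {p q : Subset n} → p ⊆ ∁ q → ∣ p ∣ + ∣ q ∣ ≤ n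
p⊆∁q⇒∣p∣+∣q∣≤n {p = p} {q} p⊆∁q =
  m≤o∸n⇒m+n≤o ∣ p ∣ (∣p∣≤n q) (subst (∣ p ∣ ≤_) (∣∁p∣≡n∸∣p∣ q) (p⊆q⇒∣p∣≤∣q∣ p⊆∁q))

∣p∪q∣≤∣p∣+∣q∣ : ∀ {n} (p q : Subset n) → ∣ p ∪ q ∣ ≤ ∣ p ∣ + ∣ q ∣
∣p∪q∣≤∣p∣+∣q∣ []            []            = z≤n
∣p∪q∣≤∣p∣+∣q∣ (inside  ∷ p) (y       ∷ q) =
  s≤s (≤-trans (∣p∪q∣≤∣p∣+∣q∣ p q) (+-monoʳ-≤ ∣ p ∣ (∣p∣≤∣x∷p∣ y q)))
∣p∪q∣≤∣p∣+∣q∣ (outside ∷ p) (inside  ∷ q) =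
  ≤-trans (s≤s (∣p∪q∣≤∣p∣+∣q∣ p q)) (≤-reflexive (sym (+-suc ∣ p ∣ ∣ q ∣)))
∣p∪q∣≤∣p∣+∣q∣ (outside ∷ p) (outside ∷ q) = ∣p∪q∣≤∣p∣+∣q∣ p q

p⊆∁q⇒∣p∪q∣≡∣p∣+∣q∣ : ∀ {n} {p q : Subset n} → p ⊆ ∁ q → ∣ p ∪ q ∣ ≡ ∣ p ∣ + ∣ q ∣
p⊆∁q⇒∣p∪q∣≡∣p∣+∣q∣ {p = []}          {[]}          _    = refl
p⊆∁q⇒∣p∪q∣≡∣p∣+∣q∣ {p = inside  ∷ p} {inside  ∷ q} p⊆∁q = contradiction (p⊆∁q here) λ ()
p⊆∁q⇒∣p∪q∣≡∣p∣+∣q∣ {p = inside  ∷ p} {outside ∷ q} p⊆∁q = cong suc (p⊆∁q⇒∣p∪q∣≡∣p∣+∣q∣ (drop-∷-⊆ p⊆∁q))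
p⊆∁q⇒∣p∪q∣≡∣p∣+∣q∣ {p = outside ∷ p} {inside  ∷ q} p⊆∁q =
  trans (cong suc (p⊆∁q⇒∣p∪q∣≡∣p∣+∣q∣ (drop-∷-⊆ p⊆∁q))) (sym (+-suc ∣ p ∣ ∣ q ∣))
p⊆∁q⇒∣p∪q∣≡∣p∣+∣q∣ {p = outside ∷ p} {outside ∷ q} p⊆∁q = p⊆∁q⇒∣p∪q∣≡∣p∣+∣q∣ (drop-∷-⊆ p⊆∁q)

suc∣p-x∣≡∣p∣ : ∀ {n} {x : Fin n} {p} → x ∈ p → suc ∣ p - x ∣ ≡ ∣ p ∣
suc∣p-x∣≡∣p∣ {x = fzero}  {inside ∷ p} here = cong (suc ∘ ∣_∣) (p─⊥≡p p)
suc∣p-x∣≡∣p∣ {x = fsuc x} {inside  ∷ p} (there x∈p) = cong suc (suc∣p-x∣≡∣p∣ x∈p)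
suc∣p-x∣≡∣p∣ {x = fsuc x} {outside ∷ p} (there x∈p) = suc∣p-x∣≡∣p∣ x∈p

x∉p-x : ∀ {n} {x : Fin n} {p} → x ∉ p - x
x∉p-x {x = fzero}  {_ ∷ p} ()
x∉p-x {x = fsuc x} {_ ∷ p} x∈p-x = x∉p-x (drop-there x∈p-x)

∈⇒⁅⁆⊆ : ∀ {n} {x : Fin n} {p} → x ∈ p → ⁅ x ⁆ ⊆ p
∈⇒⁅⁆⊆ {x = x} {p} x∈p y∈⁅x⁆ = subst (_∈ p) (sym (x∈⁅y⁆⇒x≡y x y∈⁅x⁆)) x∈p

∣⁅x⁆∪⁅y⁆∣≡2 : ∀ {n} {x y : Fin n} → x ≢ y → ∣ ⁅ x ⁆ ∪ ⁅ y ⁆ ∣ ≡ 2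
∣⁅x⁆∪⁅y⁆∣≡2 {x = x} {y} x≢y = begin
  ∣ ⁅ x ⁆ ∪ ⁅ y ⁆ ∣     ≡⟨ p⊆∁q⇒∣p∪q∣≡∣p∣+∣q∣ ⁅x⁆⊆∁⁅y⁆ ⟩
  ∣ ⁅ x ⁆ ∣ + ∣ ⁅ y ⁆ ∣ ≡⟨ cong₂ _+_ (∣⁅x⁆∣≡1 x) (∣⁅x⁆∣≡1 y) ⟩
  2                     ∎
  where
  open ≡-Reasoning
  ⁅x⁆⊆∁⁅y⁆ : ⁅ x ⁆ ⊆ ∁ ⁅ y ⁆
  ⁅x⁆⊆∁⁅y⁆ z∈⁅x⁆ = x∉p⇒x∈∁p (x≢y⇒x∉⁅y⁆ (λ z≡y → x≢y (trans (sym (x∈⁅y⁆⇒x≡y x z∈⁅x⁆)) z≡y)))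

∃-⊆-of-size : ∀ {n} (A : Subset n) j → j ≤ ∣ A ∣ → ∃ λ P → P ⊆ A × ∣ P ∣ ≡ j
∃-⊆-of-size {n} A zero _ = ⊥ , ⊥⊆ , ∣⊥∣≡0 n
∃-⊆-of-size (inside ∷ A) (suc j) (s≤s j≤∣A∣) =
  let P , P⊆A , ∣P∣≡j = ∃-⊆-of-size A j j≤∣A∣ in inside ∷ P , in⊆in P⊆A , cong suc ∣P∣≡j
∃-⊆-of-size (outside ∷ A) (suc j) j≤∣A∣ =
  let P , P⊆A , ∣P∣≡j = ∃-⊆-of-size A (suc j) j≤∣A∣ in outside ∷ P , s⊆s P⊆A , ∣P∣≡j

∃-⊇-of-size : ∀ {n} (A : Subset n) j → ∣ A ∣ ≤ j → j ≤ n → ∃ λ A′ → A ⊆ A′ × ∣ A′ ∣ ≡ j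
∃-⊇-of-size [] zero _ _ = [] , ⊆-refl , refl
∃-⊇-of-size (inside ∷ A) (suc j) (s≤s ∣A∣≤j) (s≤s j≤n) =
  let A′ , A⊆A′ , ∣A′∣≡j = ∃-⊇-of-size A j ∣A∣≤j j≤n in inside ∷ A′ , in⊆in A⊆A′ , cong suc ∣A′∣≡j
∃-⊇-of-size (outside ∷ A) zero ∣A∣≤0 _ = outside ∷ A , ⊆-refl , n≤0⇒n≡0 ∣A∣≤0
∃-⊇-of-size (outside ∷ A) (suc j) ∣A∣≤1+j (s≤s j≤n) with ∣ A ∣ ≟ suc j
... | yes ∣A∣≡1+j = outside ∷ A , ⊆-refl , ∣A∣≡1+j
... | no  ∣A∣≢1+j =
  let A′ , A⊆A′ , ∣A′∣≡j = ∃-⊇-of-size A j (m<1+n⇒m≤n (≤∧≢⇒< ∣A∣≤1+j ∣A∣≢1+j)) j≤n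
  in inside ∷ A′ , out⊆ A⊆A′ , cong suc ∣A′∣≡j

∃-∈-∖ : ∀ {n} {A A′ : Subset n} → A ⊆ A′ → ∣ A ∣ < ∣ A′ ∣ → ∃ λ b → b ∈ A′ × b ∉ A
∃-∈-∖ {A = inside  ∷ A} {outside ∷ A′} A⊆A′ _ = contradiction (A⊆A′ here) λ ()
∃-∈-∖ {A = outside ∷ A} {inside  ∷ A′} _    _ = fzero , here , λ ()
∃-∈-∖ {A = inside  ∷ A} {inside  ∷ A′} A⊆A′ (s≤s ∣A∣<∣A′∣) =
  let b , b∈A′ , b∉A = ∃-∈-∖ (drop-∷-⊆ A⊆A′) ∣A∣<∣A′∣ in fsuc b , there b∈A′ , b∉A ∘ drop-there
∃-∈-∖ {A = outside ∷ A} {outside ∷ A′} A⊆A′ ∣A∣<∣A′∣ =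
  let b , b∈A′ , b∉A = ∃-∈-∖ (drop-∷-⊆ A⊆A′) ∣A∣<∣A′∣ in fsuc b , there b∈A′ , b∉A ∘ drop-there

∣p∣>0⇒Nonempty : ∀ {n} {p : Subset n} → 0 < ∣ p ∣ → Nonempty p
∣p∣>0⇒Nonempty {n} {p} 0<∣p∣ =
  let x , x∈p , _ = ∃-∈-∖ {A = ⊥} ⊥⊆ (subst (_< ∣ p ∣) (sym (∣⊥∣≡0 n)) 0<∣p∣) in x , x∈p

⊆∁⇒Empty-∩ : ∀ {n} {p q : Subset n} → p ⊆ ∁ q → Empty (p ∩ q)
⊆∁⇒Empty-∩ {p = p} {q} p⊆∁q (x , x∈p∩q) = let x∈p , x∈q = x∈p∩q⁻ p q x∈p∩q in x∈∁p⇒x∉p (p⊆∁q x∈p) x∈q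

⊆∁-sym : ∀ {n} {p q : Subset n} → p ⊆ ∁ q → q ⊆ ∁ p
⊆∁-sym p⊆∁q x∈q = x∉p⇒x∈∁p (λ x∈p → x∈∁p⇒x∉p (p⊆∁q x∈p) x∈q)

∪-⊆ : ∀ {n} {p q r : Subset n} → p ⊆ r → q ⊆ r → p ∪ q ⊆ r
∪-⊆ {p = p} {q} p⊆r q⊆r x∈p∪q with x∈p∪q⁻ p q x∈p∪q
... | inj₁ x∈p = p⊆r x∈p
... | inj₂ x∈q = q⊆r x∈q

∈-allSubsets : ∀ {n} (S : Subset n) → S ∈ˡ allSubsets n
∈-allSubsets []            = here≡ refl
∈-allSubsets (outside ∷ S) = ∈-++⁺ˡ (∈-map⁺ (outside ∷_) (∈-allSubsets S))
∈-allSubsets (inside  ∷ S) = ∈-++⁺ʳ (map (outside ∷_) (allSubsets _)) (∈-map⁺ (inside ∷_) (∈-allSubsets S))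

-- Counting subsets

suc-∸-∸ : ∀ n a b → a + b ≤ n → suc n ∸ a ∸ b ≡ suc (n ∸ a ∸ b)
suc-∸-∸ n a b a+b≤n = begin
  suc n ∸ a ∸ b     ≡⟨ ∸-+-assoc (suc n) a b ⟩
  suc n ∸ (a + b)   ≡⟨ +-∸-assoc 1 a+b≤n ⟩
  suc (n ∸ (a + b)) ≡⟨ cong suc (∸-+-assoc n a b) ⟨
  suc (n ∸ a ∸ b)   ∎
  where open ≡-Reasoning

count-supersets-avoiding : ∀ n (X A : Subset n) m → X ⊆ ∁ A →
  ∑ˢ n (λ T → 𝟙 (X ⊆ᵇ T ∧ T ⊆ᵇ ∁ A ∧ (∣ T ∣ ≡ᵇ m + ∣ X ∣))) ≡ (n ∸ ∣ X ∣ ∸ ∣ A ∣) C m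
count-supersets-avoiding zero [] [] zero    _ = refl
count-supersets-avoiding zero [] [] (suc m) _ = refl
count-supersets-avoiding (suc n) (inside ∷ X) (inside ∷ A) m X⊆∁A = contradiction (X⊆∁A here) λ ()
count-supersets-avoiding (suc n) (inside ∷ X) (outside ∷ A) m X⊆∁A = cong₂ _+_ (∑ˢ-zero n) (begin
  ∑ˢ n (λ T → 𝟙 (X ⊆ᵇ T ∧ T ⊆ᵇ ∁ A ∧ (suc ∣ T ∣ ≡ᵇ m + suc ∣ X ∣)))
    ≡⟨ ∑ˢ-cong n (λ T → cong (λ k → 𝟙 (X ⊆ᵇ T ∧ T ⊆ᵇ ∁ A ∧ (suc ∣ T ∣ ≡ᵇ k))) (+-suc m ∣ X ∣)) ⟩
  ∑ˢ n (λ T → 𝟙 (X ⊆ᵇ T ∧ T ⊆ᵇ ∁ A ∧ (∣ T ∣ ≡ᵇ m + ∣ X ∣)))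
    ≡⟨ count-supersets-avoiding n X A m (drop-∷-⊆ X⊆∁A) ⟩
  (n ∸ ∣ X ∣ ∸ ∣ A ∣) C m ∎)
  where open ≡-Reasoning
count-supersets-avoiding (suc n) (outside ∷ X) (inside ∷ A) m X⊆∁A = begin
  ∑ˢ n (λ T → 𝟙 (X ⊆ᵇ T ∧ T ⊆ᵇ ∁ A ∧ (∣ T ∣ ≡ᵇ m + ∣ X ∣))) + ∑ˢ n (λ T → 𝟙 (X ⊆ᵇ T ∧ false))
    ≡⟨ cong₂ _+_ (count-supersets-avoiding n X A m (drop-∷-⊆ X⊆∁A))
                 (trans (∑ˢ-cong n (λ T → cong 𝟙 (∧-zeroʳ (X ⊆ᵇ T)))) (∑ˢ-zero n)) ⟩
  (n ∸ ∣ X ∣ ∸ ∣ A ∣) C m + 0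
    ≡⟨ +-identityʳ _ ⟩
  (n ∸ ∣ X ∣ ∸ ∣ A ∣) C m
    ≡⟨ cong (λ k → (k ∸ suc ∣ A ∣) C m) (+-∸-assoc 1 (∣p∣≤n X)) ⟨
  (suc n ∸ ∣ X ∣ ∸ suc ∣ A ∣) C m ∎
  where open ≡-Reasoning
count-supersets-avoiding (suc n) (outside ∷ X) (outside ∷ A) zero X⊆∁A =
  cong₂ _+_ (count-supersets-avoiding n X A zero (drop-∷-⊆ X⊆∁A))
            (trans (∑ˢ-cong n too-large) (∑ˢ-zero n))
  where
  too-large : ∀ T → 𝟙 (X ⊆ᵇ T ∧ T ⊆ᵇ ∁ A ∧ (suc ∣ T ∣ ≡ᵇ ∣ X ∣)) ≡ 0
  too-large T with X ⊆? T
  ... | no _    = refl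
  ... | yes X⊆T
    rewrite ≡ᵇ-false (suc ∣ T ∣) ∣ X ∣ (λ eq → <⇒≢ (s≤s (p⊆q⇒∣p∣≤∣q∣ X⊆T)) (sym eq))
    = cong 𝟙 (∧-zeroʳ (T ⊆ᵇ ∁ A))
count-supersets-avoiding (suc n) (outside ∷ X) (outside ∷ A) (suc m) X⊆∁A = begin
  ∑ˢ n (λ T → 𝟙 (X ⊆ᵇ T ∧ T ⊆ᵇ ∁ A ∧ (∣ T ∣ ≡ᵇ suc m + ∣ X ∣)))
    + ∑ˢ n (λ T → 𝟙 (X ⊆ᵇ T ∧ T ⊆ᵇ ∁ A ∧ (∣ T ∣ ≡ᵇ m + ∣ X ∣)))
    ≡⟨ cong₂ _+_ (count-supersets-avoiding n X A (suc m) X⊆∁A′) (count-supersets-avoiding n X A m X⊆∁A′) ⟩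
  N C suc m + N C m
    ≡⟨ +-comm (N C suc m) (N C m) ⟩
  N C m + N C suc m
    ≡⟨ nCk+nC[k+1]≡[n+1]C[k+1] N m ⟩
  suc N C suc m
    ≡⟨ cong (_C suc m) (suc-∸-∸ n ∣ X ∣ ∣ A ∣ (p⊆∁q⇒∣p∣+∣q∣≤n X⊆∁A′)) ⟨
  (suc n ∸ ∣ X ∣ ∸ ∣ A ∣) C suc m ∎
  where
  open ≡-Reasoning
  X⊆∁A′ : X ⊆ ∁ A
  N : ℕ
  X⊆∁A′ = drop-∷-⊆ X⊆∁A
  N = n ∸ ∣ X ∣ ∸ ∣ A ∣

count-supersets : ∀ n (X : Subset n) m → ∑ˢ n (λ T → 𝟙 (X ⊆ᵇ T ∧ (∣ T ∣ ≡ᵇ m + ∣ X ∣))) ≡ (n ∸ ∣ X ∣) C m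
count-supersets n X m =
  trans (∑ˢ-cong n pointwise)
        (trans (count-supersets-avoiding n X ⊥ m (λ _ → x∉p⇒x∈∁p ∉⊥))
               (cong (λ k → (n ∸ ∣ X ∣ ∸ k) C m) (∣⊥∣≡0 n)))
  where
  pointwise : ∀ T → 𝟙 (X ⊆ᵇ T ∧ (∣ T ∣ ≡ᵇ m + ∣ X ∣)) ≡ 𝟙 (X ⊆ᵇ T ∧ T ⊆ᵇ ∁ ⊥ ∧ (∣ T ∣ ≡ᵇ m + ∣ X ∣))
  pointwise T rewrite ⊆ᵇ∁⊥ T = refl

count-avoiding : ∀ n (A : Subset n) m → ∑ˢ n (λ T → 𝟙 (T ⊆ᵇ ∁ A ∧ (∣ T ∣ ≡ᵇ m))) ≡ (n ∸ ∣ A ∣) C m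
count-avoiding n A m =
  trans (∑ˢ-cong n pointwise)
        (trans (count-supersets-avoiding n ⊥ A m ⊥⊆) (cong (λ k → (n ∸ k ∸ ∣ A ∣) C m) (∣⊥∣≡0 n)))
  where
  pointwise : ∀ T → 𝟙 (T ⊆ᵇ ∁ A ∧ (∣ T ∣ ≡ᵇ m)) ≡ 𝟙 (⊥ ⊆ᵇ T ∧ T ⊆ᵇ ∁ A ∧ (∣ T ∣ ≡ᵇ m + ∣ ⊥ {n} ∣))
  pointwise T rewrite ⊥⊆ᵇ T | ∣⊥∣≡0 n | +-identityʳ m = refl

count-all : ∀ n m → ∑ˢ n (λ T → 𝟙 (∣ T ∣ ≡ᵇ m)) ≡ n C m
count-all n m = trans (∑ˢ-cong n pointwise) (trans (count-avoiding n ⊥ m) (cong (λ k → (n ∸ k) C m) (∣⊥∣≡0 n)))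
  where
  pointwise : ∀ T → 𝟙 (∣ T ∣ ≡ᵇ m) ≡ 𝟙 (T ⊆ᵇ ∁ ⊥ ∧ (∣ T ∣ ≡ᵇ m))
  pointwise T rewrite ⊆ᵇ∁⊥ T = refl

count-subsets : ∀ n (S : Subset n) m → ∑ˢ n (λ T → 𝟙 (T ⊆ᵇ S ∧ (∣ T ∣ ≡ᵇ m))) ≡ ∣ S ∣ C m
count-subsets n S m = begin
  ∑ˢ n (λ T → 𝟙 (T ⊆ᵇ S ∧ (∣ T ∣ ≡ᵇ m)))
    ≡⟨ cong (λ S′ → ∑ˢ n (λ T → 𝟙 (T ⊆ᵇ S′ ∧ (∣ T ∣ ≡ᵇ m)))) (BA.¬-involutive (∪-∩-booleanAlgebra n) S) ⟨
  ∑ˢ n (λ T → 𝟙 (T ⊆ᵇ ∁ (∁ S) ∧ (∣ T ∣ ≡ᵇ m)))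
    ≡⟨ count-avoiding n (∁ S) m ⟩
  (n ∸ ∣ ∁ S ∣) C m
    ≡⟨ cong (λ k → (n ∸ k) C m) (∣∁p∣≡n∸∣p∣ S) ⟩
  (n ∸ (n ∸ ∣ S ∣)) C m
    ≡⟨ cong (_C m) (m∸[m∸n]≡n (∣p∣≤n S)) ⟩
  ∣ S ∣ C m ∎
  where open ≡-Reasoning

∑ᵛ-mono : ∀ {m} {f g : Fin m → ℕ} → (∀ i → f i ≤ g i) → ∑[ i < m ] f i ≤ ∑[ i < m ] g i
∑ᵛ-mono {zero}  f≤g = z≤n
∑ᵛ-mono {suc m} f≤g = +-mono-≤ (f≤g fzero) (∑ᵛ-mono (f≤g ∘ fsuc))

∑ˢ-∑ᵛ-comm : ∀ n m (g : Fin m → Subset n → ℕ) → ∑ˢ n (λ S → ∑[ y < m ] g y S) ≡ ∑[ y < m ] ∑ˢ n (g y)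
∑ˢ-∑ᵛ-comm n zero    g = ∑ˢ-zero n
∑ˢ-∑ᵛ-comm n (suc m) g =
  trans (∑ˢ-distrib-+ n (g fzero) _) (cong (∑ˢ n (g fzero) +_) (∑ˢ-∑ᵛ-comm n m (g ∘ fsuc)))

∣p∣≡∑𝟙[∈p] : ∀ {n} (Y : Subset n) → ∣ Y ∣ ≡ ∑[ y < n ] 𝟙 (y ∈ᵇ Y)
∣p∣≡∑𝟙[∈p] []            = refl
∣p∣≡∑𝟙[∈p] (inside  ∷ Y) = cong suc (∣p∣≡∑𝟙[∈p] Y)
∣p∣≡∑𝟙[∈p] (outside ∷ Y) = ∣p∣≡∑𝟙[∈p] Y

𝟙[meets]≤∑𝟙[∈] : ∀ {n} (S Y : Subset n) → 𝟙 (not (S ⊆ᵇ ∁ Y)) ≤ ∑[ y < n ] (𝟙 (y ∈ᵇ Y) * 𝟙 (y ∈ᵇ S))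
𝟙[meets]≤∑𝟙[∈] []            []            = z≤n
𝟙[meets]≤∑𝟙[∈] (inside  ∷ S) (inside  ∷ Y) = s≤s z≤n
𝟙[meets]≤∑𝟙[∈] (inside  ∷ S) (outside ∷ Y) = 𝟙[meets]≤∑𝟙[∈] S Y
𝟙[meets]≤∑𝟙[∈] (outside ∷ S) (inside  ∷ Y) = 𝟙[meets]≤∑𝟙[∈] S Y
𝟙[meets]≤∑𝟙[∈] (outside ∷ S) (outside ∷ Y) = 𝟙[meets]≤∑𝟙[∈] S Y

-- Union bound over the points of Y.
count-meeting≤ : ∀ n (F : Subset n → Bool) (Y : Subset n) B →
                 (∀ {y} → y ∈ Y → ∑ˢ n (λ S → 𝟙 (F S ∧ y ∈ᵇ S)) ≤ B) →
                 ∑ˢ n (λ S → 𝟙 (F S ∧ not (S ⊆ᵇ ∁ Y))) ≤ ∣ Y ∣ * B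
count-meeting≤ n F Y B per-point = begin
  ∑ˢ n (λ S → 𝟙 (F S ∧ not (S ⊆ᵇ ∁ Y)))
    ≤⟨ ∑ˢ-mono n pointwise ⟩
  ∑ˢ n (λ S → ∑[ y < n ] (𝟙 (y ∈ᵇ Y) * 𝟙 (F S ∧ y ∈ᵇ S)))
    ≡⟨ ∑ˢ-∑ᵛ-comm n n _ ⟩
  ∑[ y < n ] ∑ˢ n (λ S → 𝟙 (y ∈ᵇ Y) * 𝟙 (F S ∧ y ∈ᵇ S))
    ≡⟨ VertexSum.sum-cong-≗ (λ y → *-distribˡ-∑ˢ n (𝟙 (y ∈ᵇ Y)) _) ⟨
  ∑[ y < n ] (𝟙 (y ∈ᵇ Y) * ∑ˢ n (λ S → 𝟙 (F S ∧ y ∈ᵇ S)))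
    ≤⟨ ∑ᵛ-mono per-vertex ⟩
  ∑[ y < n ] (𝟙 (y ∈ᵇ Y) * B)
    ≡⟨ VertexSum.*-distribʳ-sum B (λ y → 𝟙 (y ∈ᵇ Y)) ⟨
  (∑[ y < n ] 𝟙 (y ∈ᵇ Y)) * B
    ≡⟨ cong (_* B) (∣p∣≡∑𝟙[∈p] Y) ⟨
  ∣ Y ∣ * B ∎
  where
  open ≤-Reasoning
  pointwise : ∀ S → 𝟙 (F S ∧ not (S ⊆ᵇ ∁ Y)) ≤ ∑[ y < n ] (𝟙 (y ∈ᵇ Y) * 𝟙 (F S ∧ y ∈ᵇ S))
  pointwise S with F S
  ... | false = z≤n
  ... | true  = 𝟙[meets]≤∑𝟙[∈] S Y
  per-vertex : ∀ y → 𝟙 (y ∈ᵇ Y) * ∑ˢ n (λ S → 𝟙 (F S ∧ y ∈ᵇ S)) ≤ 𝟙 (y ∈ᵇ Y) * B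
  per-vertex y with y ∈? Y
  ... | yes y∈Y = *-monoʳ-≤ 1 (per-point y∈Y)
  ... | no  _   = z≤n

-- Variants of degree, norm and star whose Boolean tests compute on vector heads.
module _ {n : ℕ} where

  degree′ : Hypergraph n → Subset n → ℕ
  degree′ H T = ∑ˢ n (λ S → 𝟙 (H S ∧ T ⊆ᵇ S))

  norm′ : ℕ → ℕ → Hypergraph n → ℕ
  norm′ r k H = ∑ˢ n (λ T → if ∣ T ∣ ≡ᵇ r ∸ 1 then degree′ H T ^ k else 0)

  star′ : ℕ → Subset n → Hypergraph n
  star′ r A S = (∣ S ∣ ≡ᵇ r) ∧ not (S ⊆ᵇ ∁ A)

  degree≡degree′ : ∀ (H : Hypergraph n) T → degree H T ≡ degree′ H T
  degree≡degree′ H T = trans (sum-map-allSubsets n _)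
    (∑ˢ-cong n (λ S → cong (λ b → 𝟙 (H S ∧ b)) (isYes≗does (T ⊆? S))))

  norm≡norm′ : ∀ r k (H : Hypergraph n) → norm r k H ≡ norm′ r k H
  norm≡norm′ r k H = trans (sum-map-allSubsets n _)
    (∑ˢ-cong n (λ T → cong (λ d → if ∣ T ∣ ≡ᵇ r ∸ 1 then d ^ k else 0) (degree≡degree′ H T)))

  star≡star′ : ∀ r (A S : Subset n) → star r A S ≡ star′ r A S
  star≡star′ r A S = cong ((∣ S ∣ ≡ᵇ r) ∧_) (isYes-nonempty?-∩ S A)

  degree′-cong : ∀ {H G : Hypergraph n} → (∀ S → H S ≡ G S) → ∀ T → degree′ H T ≡ degree′ G T
  degree′-cong H≗G T = ∑ˢ-cong n (λ S → cong (λ b → 𝟙 (b ∧ T ⊆ᵇ S)) (H≗G S))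

  norm′-cong : ∀ r k {H G : Hypergraph n} → (∀ S → H S ≡ G S) → norm′ r k H ≡ norm′ r k G
  norm′-cong r k H≗G = ∑ˢ-cong n (λ T → cong (λ d → if ∣ T ∣ ≡ᵇ r ∸ 1 then d ^ k else 0) (degree′-cong H≗G T))

  degree′-mono : ∀ {H G : Hypergraph n} → (∀ S → H S ≡ true → G S ≡ true) → ∀ T → degree′ H T ≤ degree′ G T
  degree′-mono H⊆G T = ∑ˢ-mono n (λ S → 𝟙-∧-mono (T ⊆ᵇ S) (H⊆G S))

  module _ {r : ℕ} {H : Hypergraph n} (H-uniform : Uniform r H) where

    degree′≤ : ∀ T → suc ∣ T ∣ ≡ r → degree′ H T ≤ n ∸ ∣ T ∣
    degree′≤ T refl = begin
      degree′ H T                                       ≤⟨ ∑ˢ-mono n pointwise ⟩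
      ∑ˢ n (λ S → 𝟙 (T ⊆ᵇ S ∧ (∣ S ∣ ≡ᵇ 1 + ∣ T ∣)))   ≡⟨ count-supersets n T 1 ⟩
      (n ∸ ∣ T ∣) C 1                                  ≡⟨ nC1≡n (n ∸ ∣ T ∣) ⟩
      n ∸ ∣ T ∣                                        ∎
      where
      open ≤-Reasoning
      pointwise : ∀ S → 𝟙 (H S ∧ T ⊆ᵇ S) ≤ 𝟙 (T ⊆ᵇ S ∧ (∣ S ∣ ≡ᵇ 1 + ∣ T ∣))
      pointwise S with H S in eq | T ⊆ᵇ S
      ... | false | _     = z≤n
      ... | true  | false = z≤n
      ... | true  | true  rewrite H-uniform S eq | ≡ᵇ-refl (suc ∣ T ∣) = ≤-refl

  module _ (A T : Subset n) where

    degree′-star′-meeting : ∀ {r} → suc ∣ T ∣ ≡ r → ¬ T ⊆ ∁ A → degree′ (star′ r A) T ≡ n ∸ ∣ T ∣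
    degree′-star′-meeting {r} refl T⊈∁A = begin
      degree′ (star′ r A) T                             ≡⟨ ∑ˢ-cong n pointwise ⟩
      ∑ˢ n (λ S → 𝟙 (T ⊆ᵇ S ∧ (∣ S ∣ ≡ᵇ 1 + ∣ T ∣)))   ≡⟨ count-supersets n T 1 ⟩
      (n ∸ ∣ T ∣) C 1                                  ≡⟨ nC1≡n (n ∸ ∣ T ∣) ⟩
      n ∸ ∣ T ∣                                        ∎
      where
      open ≡-Reasoning
      pointwise : ∀ S → 𝟙 (star′ r A S ∧ T ⊆ᵇ S) ≡ 𝟙 (T ⊆ᵇ S ∧ (∣ S ∣ ≡ᵇ 1 + ∣ T ∣))
      pointwise S with T ⊆? S
      ... | no _ = cong 𝟙 (∧-zeroʳ (star′ r A S))
      ... | yes T⊆S rewrite dec-false (S ⊆? ∁ A) (T⊈∁A ∘ ⊆-trans T⊆S) =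
        cong 𝟙 (trans (∧-identityʳ _) (∧-identityʳ _))

    degree′-star′-avoiding : ∀ {r} → suc ∣ T ∣ ≡ r → T ⊆ ∁ A → degree′ (star′ r A) T ≡ ∣ A ∣
    degree′-star′-avoiding {r} refl T⊆∁A = begin
      d                                   ≡⟨ m+n∸n≡m d e ⟨
      d + e ∸ e                           ≡⟨ cong (_∸ e) d+e≡n-∣T∣ ⟩
      (n ∸ ∣ T ∣) ∸ e                     ≡⟨ cong ((n ∸ ∣ T ∣) ∸_) e≡n-∣T∣-∣A∣ ⟩
      (n ∸ ∣ T ∣) ∸ (n ∸ ∣ T ∣ ∸ ∣ A ∣)   ≡⟨ m∸[m∸n]≡n ∣A∣≤n-∣T∣ ⟩
      ∣ A ∣                               ∎
      where
      open ≡-Reasoning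
      d e : ℕ
      d = degree′ (star′ r A) T
      e = ∑ˢ n (λ S → 𝟙 (T ⊆ᵇ S ∧ S ⊆ᵇ ∁ A ∧ (∣ S ∣ ≡ᵇ 1 + ∣ T ∣)))
      pointwise : ∀ S → 𝟙 (T ⊆ᵇ S ∧ (∣ S ∣ ≡ᵇ 1 + ∣ T ∣))
                  ≡ 𝟙 (((∣ S ∣ ≡ᵇ 1 + ∣ T ∣) ∧ not (S ⊆ᵇ ∁ A)) ∧ T ⊆ᵇ S)
                    + 𝟙 (T ⊆ᵇ S ∧ S ⊆ᵇ ∁ A ∧ (∣ S ∣ ≡ᵇ 1 + ∣ T ∣))
      pointwise S = split (T ⊆ᵇ S) (∣ S ∣ ≡ᵇ 1 + ∣ T ∣) (S ⊆ᵇ ∁ A)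
        where
        split : ∀ a b c → 𝟙 (a ∧ b) ≡ 𝟙 ((b ∧ not c) ∧ a) + 𝟙 (a ∧ c ∧ b)
        split true  true  true  = refl
        split true  true  false = refl
        split true  false true  = refl
        split true  false false = refl
        split false true  true  = refl
        split false true  false = refl
        split false false true  = refl
        split false false false = refl
      d+e≡n-∣T∣ : d + e ≡ n ∸ ∣ T ∣
      d+e≡n-∣T∣ = begin
        d + e  ≡⟨ ∑ˢ-distrib-+ n _ _ ⟨
        ∑ˢ n (λ S → 𝟙 (star′ r A S ∧ T ⊆ᵇ S) + 𝟙 (T ⊆ᵇ S ∧ S ⊆ᵇ ∁ A ∧ (∣ S ∣ ≡ᵇ 1 + ∣ T ∣)))
               ≡⟨ ∑ˢ-cong n pointwise ⟨
        ∑ˢ n (λ S → 𝟙 (T ⊆ᵇ S ∧ (∣ S ∣ ≡ᵇ 1 + ∣ T ∣)))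
               ≡⟨ count-supersets n T 1 ⟩
        (n ∸ ∣ T ∣) C 1
               ≡⟨ nC1≡n (n ∸ ∣ T ∣) ⟩
        n ∸ ∣ T ∣ ∎
      e≡n-∣T∣-∣A∣ : e ≡ n ∸ ∣ T ∣ ∸ ∣ A ∣
      e≡n-∣T∣-∣A∣ = trans (count-supersets-avoiding n T A 1 T⊆∁A) (nC1≡n _)
      ∣A∣≤n-∣T∣ : ∣ A ∣ ≤ n ∸ ∣ T ∣
      ∣A∣≤n-∣T∣ = m+n≤o⇒m≤o∸n ∣ A ∣ (subst (_≤ n) (+-comm ∣ T ∣ ∣ A ∣) (p⊆∁q⇒∣p∣+∣q∣≤n T⊆∁A))

-- In the (1 + p)-uniform star with centre A, a p-set meeting A has degree n - p and one avoiding A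
-- has degree ∣ A ∣.
starNorm : ℕ → ℕ → ℕ → ℕ → ℕ
starNorm n p k a = (n ∸ p) ^ k * (n C p ∸ (n ∸ a) C p) + a ^ k * ((n ∸ a) C p)

norm′-star′ : ∀ n p k (A : Subset n) → norm′ (suc p) k (star′ (suc p) A) ≡ starNorm n p k ∣ A ∣
norm′-star′ n p k A = begin
  norm′ (suc p) k (star′ (suc p) A)     ≡⟨ ∑ˢ-cong n pointwise ⟩
  ∑ˢ n (λ T → D ^ k * 𝟙 (meeting T) + a ^ k * 𝟙 (avoiding T))
                                       ≡⟨ ∑ˢ-distrib-+ n _ _ ⟩
  ∑ˢ n (λ T → D ^ k * 𝟙 (meeting T)) + ∑ˢ n (λ T → a ^ k * 𝟙 (avoiding T))
                                       ≡⟨ cong₂ _+_ (*-distribˡ-∑ˢ n (D ^ k) _) (*-distribˡ-∑ˢ n (a ^ k) _) ⟨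
  D ^ k * #meeting + a ^ k * #avoiding ≡⟨ cong (λ x → D ^ k * x + a ^ k * #avoiding) #meeting≡ ⟩
  D ^ k * (n C p ∸ #avoiding) + a ^ k * #avoiding
                                       ≡⟨ cong (λ x → D ^ k * (n C p ∸ x) + a ^ k * x) #avoiding≡ ⟩
  starNorm n p k a                     ∎
  where
  open ≡-Reasoning
  D a : ℕ
  D = n ∸ p
  a = ∣ A ∣
  meeting avoiding : Subset n → Bool
  meeting  T = (∣ T ∣ ≡ᵇ p) ∧ not (T ⊆ᵇ ∁ A)
  avoiding T = (∣ T ∣ ≡ᵇ p) ∧ T ⊆ᵇ ∁ A
  #meeting #avoiding : ℕ
  #meeting = ∑ˢ n (𝟙 ∘ meeting)
  #avoiding = ∑ˢ n (𝟙 ∘ avoiding)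
  pointwise : ∀ T → (if ∣ T ∣ ≡ᵇ p then degree′ (star′ (suc p) A) T ^ k else 0)
                  ≡ D ^ k * 𝟙 (meeting T) + a ^ k * 𝟙 (avoiding T)
  pointwise T with ∣ T ∣ ≡ᵇ p in ∣T∣≡p | T ⊆? ∁ A
  ... | false | _ = sym (cong₂ _+_ (*-zeroʳ (D ^ k)) (*-zeroʳ (a ^ k)))
  ... | true | yes T⊆∁A
    rewrite degree′-star′-avoiding A T (cong suc (≡ᵇ-true⇒≡ _ _ ∣T∣≡p)) T⊆∁A
    = trans (sym (*-identityʳ (a ^ k))) (cong (_+ a ^ k * 1) (sym (*-zeroʳ (D ^ k))))
  ... | true | no T⊈∁A = begin
    degree′ (star′ (suc p) A) T ^ k ≡⟨ cong (_^ k) (degree′-star′-meeting A T (cong suc ∣T∣≡p′) T⊈∁A) ⟩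
    (n ∸ ∣ T ∣) ^ k                 ≡⟨ cong (λ x → (n ∸ x) ^ k) ∣T∣≡p′ ⟩
    D ^ k                           ≡⟨ *-identityʳ (D ^ k) ⟨
    D ^ k * 1                       ≡⟨ +-identityʳ _ ⟨
    D ^ k * 1 + 0                   ≡⟨ cong (D ^ k * 1 +_) (*-zeroʳ (a ^ k)) ⟨
    D ^ k * 1 + a ^ k * 0           ∎
    where
    ∣T∣≡p′ : ∣ T ∣ ≡ p
    ∣T∣≡p′ = ≡ᵇ-true⇒≡ ∣ T ∣ p ∣T∣≡p
  #meeting+#avoiding : #meeting + #avoiding ≡ n C p
  #meeting+#avoiding = begin
    #meeting + #avoiding             ≡⟨ ∑ˢ-distrib-+ n _ _ ⟨
    ∑ˢ n (λ T → 𝟙 (meeting T) + 𝟙 (avoiding T))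
                                     ≡⟨ ∑ˢ-cong n (λ T → 𝟙-split (∣ T ∣ ≡ᵇ p) (T ⊆ᵇ ∁ A)) ⟨
    ∑ˢ n (λ T → 𝟙 (∣ T ∣ ≡ᵇ p))       ≡⟨ count-all n p ⟩
    n C p                            ∎
  #meeting≡ : #meeting ≡ n C p ∸ #avoiding
  #meeting≡ = trans (sym (m+n∸n≡m #meeting #avoiding)) (cong (_∸ #avoiding) #meeting+#avoiding)
  #avoiding≡ : #avoiding ≡ (n ∸ a) C p
  #avoiding≡ = trans (∑ˢ-cong n (λ T → cong 𝟙 (∧-comm (∣ T ∣ ≡ᵇ p) (T ⊆ᵇ ∁ A)))) (count-avoiding n A p)

module _ {n : ℕ} where

  handshake : ∀ p {G : Hypergraph n} → Uniform (suc p) G →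
    ∑ˢ n (λ T → if ∣ T ∣ ≡ᵇ p then degree′ G T else 0) ≡ suc p * ∑ˢ n (λ S → 𝟙 (G S))
  handshake p {G} G-uniform = begin
    ∑ˢ n (λ T → if ∣ T ∣ ≡ᵇ p then degree′ G T else 0)
      ≡⟨ ∑ˢ-cong n (λ T → trans (if-𝟙 (∣ T ∣ ≡ᵇ p) _)
                                (*-distribˡ-∑ˢ n (𝟙 (∣ T ∣ ≡ᵇ p)) (λ S → 𝟙 (G S ∧ T ⊆ᵇ S)))) ⟩
    ∑ˢ n (λ T → ∑ˢ n (λ S → 𝟙 (∣ T ∣ ≡ᵇ p) * 𝟙 (G S ∧ T ⊆ᵇ S)))
      ≡⟨ ∑ˢ-comm n n _ ⟩
    ∑ˢ n (λ S → ∑ˢ n (λ T → 𝟙 (∣ T ∣ ≡ᵇ p) * 𝟙 (G S ∧ T ⊆ᵇ S)))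
      ≡⟨ ∑ˢ-cong n (λ S → ∑ˢ-cong n (λ T → 𝟙-rearrange (∣ T ∣ ≡ᵇ p) (G S) (T ⊆ᵇ S))) ⟩
    ∑ˢ n (λ S → ∑ˢ n (λ T → 𝟙 (G S) * 𝟙 (T ⊆ᵇ S ∧ (∣ T ∣ ≡ᵇ p))))
      ≡⟨ ∑ˢ-cong n (λ S → trans (sym (*-distribˡ-∑ˢ n (𝟙 (G S)) _)) (cong (𝟙 (G S) *_) (count-subsets n S p))) ⟩
    ∑ˢ n (λ S → 𝟙 (G S) * (∣ S ∣ C p))
      ≡⟨ ∑ˢ-cong n edge-term ⟩
    ∑ˢ n (λ S → suc p * 𝟙 (G S))
      ≡⟨ *-distribˡ-∑ˢ n (suc p) _ ⟨
    suc p * ∑ˢ n (λ S → 𝟙 (G S)) ∎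
    where
    open ≡-Reasoning
    𝟙-rearrange : ∀ a b c → 𝟙 a * 𝟙 (b ∧ c) ≡ 𝟙 b * 𝟙 (c ∧ a)
    𝟙-rearrange a b c = begin
      𝟙 a * 𝟙 (b ∧ c)       ≡⟨ cong (𝟙 a *_) (𝟙-∧ b c) ⟩
      𝟙 a * (𝟙 b * 𝟙 c)     ≡⟨ x∙yz≈y∙xz (𝟙 a) (𝟙 b) (𝟙 c) ⟩
      𝟙 b * (𝟙 a * 𝟙 c)     ≡⟨ cong (𝟙 b *_) (trans (*-comm (𝟙 a) (𝟙 c)) (sym (𝟙-∧ c a))) ⟩
      𝟙 b * 𝟙 (c ∧ a)       ∎
    edge-term : ∀ S → 𝟙 (G S) * (∣ S ∣ C p) ≡ suc p * 𝟙 (G S)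
    edge-term S with G S in GS
    ... | false = sym (*-zeroʳ (suc p))
    ... | true  rewrite G-uniform S GS = begin
      1 * (suc p C p)       ≡⟨ *-identityˡ _ ⟩
      suc p C p             ≡⟨ nCk≡nC[n∸k] (n≤1+n p) ⟩
      suc p C (suc p ∸ p)   ≡⟨ cong (suc p C_) (m+n∸n≡m 1 p) ⟩
      suc p C 1             ≡⟨ nC1≡n (suc p) ⟩
      suc p                 ≡⟨ *-identityʳ (suc p) ⟨
      suc p * 1             ∎

  norm′-mono : ∀ r k {G G′ : Hypergraph n} → (∀ S → G S ≡ true → G′ S ≡ true) → norm′ r k G ≤ norm′ r k G′
  norm′-mono r k G⊆G′ = ∑ˢ-mono n (λ T → if-0-mono (∣ T ∣ ≡ᵇ r ∸ 1) (^-monoˡ-≤ k (degree′-mono G⊆G′ T)))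

  -- Removing an r-set S from a hypergraph lowers the degree of the (r-1)-set S - v.
  norm′-mono-< : ∀ p k {G G′ : Hypergraph n} → (∀ S → G S ≡ true → G′ S ≡ true) →
                 ∀ S → G S ≡ false → G′ S ≡ true → ∣ S ∣ ≡ suc p →
                 norm′ (suc p) (suc k) G < norm′ (suc p) (suc k) G′
  norm′-mono-< p k {G} {G′} G⊆G′ S GS G′S ∣S∣≡1+p =
    ∑ˢ-mono-< (λ T → if-0-mono (∣ T ∣ ≡ᵇ p) (^-monoˡ-≤ (suc k) (degree′-mono G⊆G′ T))) T
      (subst (λ b → (if b then degree′ G T ^ suc k else 0) < (if b then degree′ G′ T ^ suc k else 0))
             (sym (trans (cong (_≡ᵇ p) ∣T∣≡p) (≡ᵇ-refl p))) (^-monoˡ-< (suc k) degree<))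
    where
    v∈S : Nonempty S
    v∈S = ∣p∣>0⇒Nonempty {p = S} (subst (0 <_) (sym ∣S∣≡1+p) (s≤s z≤n))
    T = S - proj₁ v∈S
    ∣T∣≡p : ∣ T ∣ ≡ p
    ∣T∣≡p = suc-injective (trans (suc∣p-x∣≡∣p∣ (proj₂ v∈S)) ∣S∣≡1+p)
    degree< : degree′ G T < degree′ G′ T
    degree< = ∑ˢ-mono-< (λ S′ → 𝟙-∧-mono (T ⊆ᵇ S′) (G⊆G′ S′)) S
                        (𝟙-∧-< GS G′S (dec-true (T ⊆? S) (p─q⊆p S ⁅ proj₁ v∈S ⁆)))

star′-mono : ∀ {n} r {A A′ : Subset n} → A ⊆ A′ → ∀ S → star′ r A S ≡ true → star′ r A′ S ≡ true
star′-mono r {A} {A′} A⊆A′ S starS with S ⊆? ∁ A | S ⊆? ∁ A′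
... | no _     | no _       = starS
... | yes _    | _          = contradiction (∧-conicalʳ (∣ S ∣ ≡ᵇ r) false starS) λ ()
... | no S⊈∁A  | yes S⊆∁A′  = contradiction (λ {x} x∈S → p⊆q⇒∁p⊇∁q A⊆A′ (S⊆∁A′ x∈S)) S⊈∁A

norm-cong : ∀ {n} r k {G G′ : Hypergraph n} → (∀ S → G S ≡ G′ S) → norm r k G ≡ norm r k G′
norm-cong r k {G} {G′} G≗G′ = trans (norm≡norm′ r k G) (trans (norm′-cong r k G≗G′) (sym (norm≡norm′ r k G′)))

norm-star : ∀ {n} p k (A : Subset n) → norm (suc p) k (star (suc p) A) ≡ starNorm n p k ∣ A ∣
norm-star p k A =
  trans (norm-cong (suc p) k (star≡star′ (suc p) A))
        (trans (norm≡norm′ (suc p) k (star′ (suc p) A)) (norm′-star′ _ p k A))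

-- Matchings

module _ {n : ℕ} where

  vertexDegree : Hypergraph n → Fin n → ℕ
  vertexDegree H v = ∑ˢ n (λ S → 𝟙 (H S ∧ v ∈ᵇ S))

  IsMatching : ∀ {m} → Hypergraph n → (Fin m → Subset n) → Set
  IsMatching H M = (∀ i → H (M i) ≡ true) × (∀ i j → i ≢ j → Empty (M i ∩ M j))

  vertices : ∀ {m} → (Fin m → Subset n) → Subset n
  vertices {zero}  M = ⊥
  vertices {suc m} M = M fzero ∪ vertices (M ∘ fsuc)

  ⊆-vertices : ∀ {m} (M : Fin m → Subset n) i → M i ⊆ vertices M
  ⊆-vertices M fzero    = p⊆p∪q (vertices (M ∘ fsuc))
  ⊆-vertices M (fsuc i) = q⊆p∪q (M fzero) _ ∘ ⊆-vertices (M ∘ fsuc) i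

  vertices-⊆ : ∀ {m} {M : Fin m → Subset n} {X} → (∀ i → M i ⊆ X) → vertices M ⊆ X
  vertices-⊆ {zero}  _      x∈⊥ = contradiction x∈⊥ ∉⊥
  vertices-⊆ {suc m} M⊆X = ∪-⊆ (M⊆X fzero) (vertices-⊆ (M⊆X ∘ fsuc))

  ∣vertices∣≤ : ∀ {m} r (M : Fin m → Subset n) → (∀ i → ∣ M i ∣ ≡ r) → ∣ vertices M ∣ ≤ r * m
  ∣vertices∣≤ {zero}  r M _ = ≤-reflexive (trans (∣⊥∣≡0 n) (sym (*-zeroʳ r)))
  ∣vertices∣≤ {suc m} r M ∣M∣≡r = begin
    ∣ M fzero ∪ vertices (M ∘ fsuc) ∣       ≤⟨ ∣p∪q∣≤∣p∣+∣q∣ (M fzero) _ ⟩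
    ∣ M fzero ∣ + ∣ vertices (M ∘ fsuc) ∣   ≤⟨ +-mono-≤ (≤-reflexive (∣M∣≡r fzero))
                                                       (∣vertices∣≤ r (M ∘ fsuc) (∣M∣≡r ∘ fsuc)) ⟩
    r + r * m                              ≡⟨ *-suc r m ⟨
    r * suc m                              ∎
    where open ≤-Reasoning

  IsMatching-∷ : ∀ {m} {H : Hypergraph n} {e} {M : Fin m → Subset n} →
                 H e ≡ true → e ⊆ ∁ (vertices M) → IsMatching H M → IsMatching H (e ∷ᶠ M)
  IsMatching-∷ {H = H} {e} {M} He e⊆∁V (HM , disjoint) = edges , pairwise
    where
    e⊆∁M : ∀ i → e ⊆ ∁ (M i)
    e⊆∁M i = p⊆q⇒∁p⊇∁q (⊆-vertices M i) ∘ e⊆∁V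
    edges : ∀ i → H ((e ∷ᶠ M) i) ≡ true
    edges fzero    = He
    edges (fsuc i) = HM i
    pairwise : ∀ i j → i ≢ j → Empty ((e ∷ᶠ M) i ∩ (e ∷ᶠ M) j)
    pairwise fzero    fzero    i≢j = contradiction refl i≢j
    pairwise fzero    (fsuc j) _   = ⊆∁⇒Empty-∩ (e⊆∁M j)
    pairwise (fsuc i) fzero    _   = ⊆∁⇒Empty-∩ (⊆∁-sym (e⊆∁M i))
    pairwise (fsuc i) (fsuc j) i≢j = disjoint i j (i≢j ∘ cong fsuc)

  IsMatching-take : ∀ {m t} {H : Hypergraph n} {M : Fin m → Subset n} → (t≤m : t ≤ m) →
                    IsMatching H M → IsMatching H (λ i → M (inject≤ i t≤m))
  IsMatching-take t≤m (HM , disjoint) =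
    (λ i → HM (inject≤ i t≤m)) , λ i j i≢j → disjoint _ _ (i≢j ∘ inject≤-injective t≤m t≤m i j)

  ∃-maximal-matching : (G : Hypergraph n) → (∀ S → G S ≡ true → Nonempty S) → (xs : List (Subset n)) →
    ∃₂ λ m (M : Fin m → Subset n) → IsMatching G M × (∀ {S} → S ∈ˡ xs → G S ≡ true → ¬ S ⊆ ∁ (vertices M))
  ∃-maximal-matching G nonempty [] = 0 , (λ ()) , ((λ ()) , (λ ())) , (λ ())
  ∃-maximal-matching G nonempty (S ∷ xs)
    with ∃-maximal-matching G nonempty xs
  ... | m , M , matching , meets with G S in GS | S ⊆? ∁ (vertices M)
  ...   | true | yes S⊆∁V = suc m , S ∷ᶠ M , IsMatching-∷ GS S⊆∁V matching , meets′
    where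
    V⊆V′ : vertices M ⊆ vertices (S ∷ᶠ M)
    V⊆V′ = q⊆p∪q S (vertices M)
    meets′ : ∀ {T} → T ∈ˡ S ∷ xs → G T ≡ true → ¬ T ⊆ ∁ (vertices (S ∷ᶠ M))
    meets′ (here≡ refl) _ S⊆∁V′ = let x , x∈S = nonempty S GS in x∈∁p⇒x∉p (S⊆∁V′ x∈S) (p⊆p∪q _ x∈S)
    meets′ (there≡ T∈xs) GT T⊆∁V′ = meets T∈xs GT (p⊆q⇒∁p⊇∁q V⊆V′ ∘ T⊆∁V′)
  ...   | true | no S⊈∁V = m , M , matching , meets′
    where
    meets′ : ∀ {T} → T ∈ˡ S ∷ xs → G T ≡ true → ¬ T ⊆ ∁ (vertices M)
    meets′ (here≡ refl)  _  = S⊈∁V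
    meets′ (there≡ T∈xs) GT = meets T∈xs GT
  ...   | false | _ = m , M , matching , meets′
    where
    meets′ : ∀ {T} → T ∈ˡ S ∷ xs → G T ≡ true → ¬ T ⊆ ∁ (vertices M)
    meets′ (here≡ refl)  GT = contradiction (trans (sym GT) GS) λ ()
    meets′ (there≡ T∈xs) GT = meets T∈xs GT

codegree≤ : ∀ {n p} {H : Hypergraph n} → Uniform (2 + p) H → ∀ {x y} → x ≢ y →
            ∑ˢ n (λ S → 𝟙 ((H S ∧ x ∈ᵇ S) ∧ y ∈ᵇ S)) ≤ (n ∸ 2) C p
codegree≤ {n} {p} {H} H-uniform {x} {y} x≢y = begin
  ∑ˢ n (λ S → 𝟙 ((H S ∧ x ∈ᵇ S) ∧ y ∈ᵇ S))               ≤⟨ ∑ˢ-mono n pointwise ⟩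
  ∑ˢ n (λ S → 𝟙 (X ⊆ᵇ S ∧ (∣ S ∣ ≡ᵇ p + ∣ X ∣)))         ≡⟨ count-supersets n X p ⟩
  (n ∸ ∣ X ∣) C p                                       ≡⟨ cong (λ k → (n ∸ k) C p) (∣⁅x⁆∪⁅y⁆∣≡2 x≢y) ⟩
  (n ∸ 2) C p                                           ∎
  where
  open ≤-Reasoning
  X : Subset n
  X = ⁅ x ⁆ ∪ ⁅ y ⁆
  pointwise : ∀ S → 𝟙 ((H S ∧ x ∈ᵇ S) ∧ y ∈ᵇ S) ≤ 𝟙 (X ⊆ᵇ S ∧ (∣ S ∣ ≡ᵇ p + ∣ X ∣))
  pointwise S with H S in HS | x ∈? S | y ∈? S
  ... | false | _       | _       = z≤n
  ... | true  | no _    | _       = z≤n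
  ... | true  | yes _   | no _    = z≤n
  ... | true  | yes x∈S | yes y∈S
    rewrite dec-true (X ⊆? S) (∪-⊆ (∈⇒⁅⁆⊆ x∈S) (∈⇒⁅⁆⊆ y∈S)) | H-uniform S HS | ∣⁅x⁆∪⁅y⁆∣≡2 x≢y
          | +-comm p 2 | ≡ᵇ-refl (2 + p) = ≤-refl

module Greedy {n : ℕ} (H : Hypergraph n) {r : ℕ} (H-uniform : Uniform r H) (1≤r : 1 ≤ r) (s Q : ℕ)
  (codegree≤Q : ∀ {x y} → x ≢ y → ∑ˢ n (λ S → 𝟙 ((H S ∧ x ∈ᵇ S) ∧ y ∈ᵇ S)) ≤ Q) where

  edge-avoiding : ∀ v {Y} → v ∉ Y → ∣ Y ∣ * Q < vertexDegree H v → ∃ λ e → H e ≡ true × v ∈ e × e ⊆ ∁ Y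
  edge-avoiding v {Y} v∉Y ∣Y∣*Q<deg = extract (∑ˢ-positive n good #good>0)
    where
    good bad : Subset n → ℕ
    good S = 𝟙 ((H S ∧ v ∈ᵇ S) ∧ S ⊆ᵇ ∁ Y)
    bad  S = 𝟙 ((H S ∧ v ∈ᵇ S) ∧ not (S ⊆ᵇ ∁ Y))
    #bad≤ : ∑ˢ n bad ≤ ∣ Y ∣ * Q
    #bad≤ = count-meeting≤ n (λ S → H S ∧ v ∈ᵇ S) Y Q (λ {y} y∈Y → codegree≤Q {v} {y} (λ { refl → v∉Y y∈Y }))
    #good>0 : 0 < ∑ˢ n good
    #good>0 = ≰⇒> λ #good≤0 → <⇒≱ ∣Y∣*Q<deg (begin
      vertexDegree H v       ≡⟨ ∑ˢ-cong n (λ S → 𝟙-split (H S ∧ v ∈ᵇ S) (S ⊆ᵇ ∁ Y)) ⟩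
      ∑ˢ n (λ S → bad S + good S) ≡⟨ ∑ˢ-distrib-+ n bad good ⟩
      ∑ˢ n bad + ∑ˢ n good   ≤⟨ +-mono-≤ #bad≤ #good≤0 ⟩
      ∣ Y ∣ * Q + 0          ≡⟨ +-identityʳ _ ⟩
      ∣ Y ∣ * Q              ∎)
      where open ≤-Reasoning
    extract : (∃ λ S → 0 < good S) → ∃ λ e → H e ≡ true × v ∈ e × e ⊆ ∁ Y
    extract (S , 0<good) with H S in HS | v ∈? S | S ⊆? ∁ Y
    ... | true  | yes v∈S | yes S⊆∁Y = S , HS , v∈S , S⊆∁Y
    ... | true  | yes _   | no _     = contradiction 0<good λ ()
    ... | true  | no _    | _        = contradiction 0<good λ ()
    ... | false | _       | _        = contradiction 0<good λ ()

  -- Vertices of degree above r s Q can be matched one by one, since a partial matching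
  -- together with the remaining vertices never covers more than r s vertices.
  extend-matching : ∀ j {m} {M : Fin m → Subset n} {P : Subset n} → IsMatching H M → ∣ P ∣ ≡ j → m + j ≤ s →
                    (∀ {w} → w ∈ P → r * s * Q < vertexDegree H w) → P ⊆ ∁ (vertices M) → HasMatching (m + j) H
  extend-matching zero {m} {M} matching _ _ _ _ =
    subst (λ t → HasMatching t H) (sym (+-identityʳ m)) (M , matching)
  extend-matching (suc j) {m} {M} {P} matching ∣P∣≡1+j m+1+j≤s high P⊆∁V =
    subst (λ t → HasMatching t H) (sym (+-suc m j))
      (extend-matching j (IsMatching-∷ {H = H} He e⊆∁V matching) ∣P′∣≡j (subst (_≤ s) (+-suc m j) m+1+j≤s)
                         (high ∘ p─q⊆p P ⁅ v ⁆) P′⊆∁V′)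
    where
    v∈P : ∃ λ v → v ∈ P
    v∈P = let v , v∈P , _ = ∃-∈-∖ ⊥⊆ (subst₂ _<_ (sym (∣⊥∣≡0 n)) (sym ∣P∣≡1+j) (s≤s z≤n)) in v , v∈P
    v : Fin n
    v = proj₁ v∈P
    P′ : Subset n
    P′ = P - v
    ∣P′∣≡j : ∣ P′ ∣ ≡ j
    ∣P′∣≡j = suc-injective (trans (suc∣p-x∣≡∣p∣ (proj₂ v∈P)) ∣P∣≡1+j)
    Y : Subset n
    Y = vertices M ∪ P′
    v∉Y : v ∉ Y
    v∉Y v∈Y with x∈p∪q⁻ (vertices M) P′ v∈Y
    ... | inj₁ v∈V  = x∈∁p⇒x∉p (P⊆∁V (proj₂ v∈P)) v∈V
    ... | inj₂ v∈P′ = x∉p-x v∈P′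
    ∣Y∣≤r*s : ∣ Y ∣ ≤ r * s
    ∣Y∣≤r*s = begin
      ∣ Y ∣                    ≤⟨ ∣p∪q∣≤∣p∣+∣q∣ (vertices M) P′ ⟩
      ∣ vertices M ∣ + ∣ P′ ∣   ≤⟨ +-mono-≤ (∣vertices∣≤ r M (λ i → H-uniform (M i) (proj₁ matching i)))
                                           (≤-reflexive ∣P′∣≡j) ⟩
      r * m + j                ≤⟨ +-monoʳ-≤ (r * m) (subst (_≤ r * j) (*-identityˡ j) (*-monoˡ-≤ j 1≤r)) ⟩
      r * m + r * j            ≡⟨ *-distribˡ-+ r m j ⟨
      r * (m + j)              ≤⟨ *-monoʳ-≤ r (≤-trans (+-monoʳ-≤ m (n≤1+n j)) m+1+j≤s) ⟩
      r * s                    ∎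
      where open ≤-Reasoning
    edge : ∃ λ e → H e ≡ true × v ∈ e × e ⊆ ∁ Y
    edge = edge-avoiding v v∉Y (≤-<-trans (*-monoˡ-≤ Q ∣Y∣≤r*s) (high (proj₂ v∈P)))
    e : Subset n
    e = proj₁ edge
    He : H e ≡ true
    He = proj₁ (proj₂ edge)
    e⊆∁Y : e ⊆ ∁ Y
    e⊆∁Y = proj₂ (proj₂ (proj₂ edge))
    e⊆∁V : e ⊆ ∁ (vertices M)
    e⊆∁V = p⊆q⇒∁p⊇∁q (p⊆p∪q P′) ∘ e⊆∁Y
    P′⊆∁V′ : P′ ⊆ ∁ (e ∪ vertices M)
    P′⊆∁V′ = ⊆∁-sym (∪-⊆ (p⊆q⇒∁p⊇∁q (q⊆p∪q (vertices M) P′) ∘ e⊆∁Y)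
                         (⊆∁-sym (P⊆∁V ∘ p─q⊆p P ⁅ v ⁆)))

∣initSeg∣ : ∀ {n} s → s ≤ n → ∣ initSeg {n} (suc s) ∣ ≡ s
∣initSeg∣ {zero}  zero    _         = refl
∣initSeg∣ {suc n} zero    _         = ∣initSeg∣ {n} zero z≤n
∣initSeg∣ {suc n} (suc s) (s≤s s≤n) = cong suc (∣initSeg∣ s s≤n)

-- The error term r |H′| is at most c(r, s) times the number of sets gaining degree, and beyond
-- n₀(s, k, r) the gain per set, D^k - |A|^k, exceeds k D^(k-1) c(r, s).
errorConstant : ℕ → ℕ → ℕ
errorConstant r s = r * (r * s * (r * s * 2 ^ s))

threshold : ℕ → ℕ → ℕ → ℕ
threshold s k r = k * errorConstant r s + s + 2 * r

module StarBound (s′ q p : ℕ) {n : ℕ} (n-large : threshold (suc s′) (suc q) (2 + p) < n)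
            (H : Hypergraph n) (H-uniform : Uniform (2 + p) H) (no-matching : ¬ HasMatching (suc s′) H) where

  s k r D Q L : ℕ
  s = suc s′
  k = suc q
  r = 2 + p
  D = n ∸ suc p
  Q = (n ∸ 2) C p
  L = r * s * Q

  open Greedy H H-uniform (s≤s z≤n) s Q (codegree≤ H-uniform)

  s′≤n : s′ ≤ n
  s′≤n = ≤-trans (≤-trans (n≤1+n s′) (≤-trans (m≤n+m s _) (m≤m+n _ (2 * r)))) (<⇒≤ n-large)

  A : Subset n
  A = tabulate (λ v → does (L <? vertexDegree H v))

  a : ℕ
  a = ∣ A ∣

  high : ∀ {v} → v ∈ A → L < vertexDegree H v
  high {v} v∈A = does-true⇒ (L <? vertexDegree H v) (trans (sym (lookup∘tabulate _ v)) ([]=⇒lookup v∈A))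

  low : ∀ {v} → v ∉ A → vertexDegree H v ≤ L
  low {v} v∉A = ≮⇒≥ λ L<deg → v∉A (lookup⇒[]= v A (trans (lookup∘tabulate _ v) (dec-true (L <? _) L<deg)))

  a<s : a < s
  a<s with s ≤? a
  ... | no  s≰a = ≰⇒> s≰a
  ... | yes s≤a =
    let P , P⊆A , ∣P∣≡s = ∃-⊆-of-size A s s≤a
    in contradiction (extend-matching s {m = 0} {M = λ ()} ((λ ()) , (λ ())) ∣P∣≡s ≤-refl (high ∘ P⊆A)
                                      (λ _ → x∉p⇒x∈∁p ∉⊥))
                     no-matching

  H′ : Hypergraph n
  H′ S = H S ∧ S ⊆ᵇ ∁ A

  H′-uniform : Uniform r H′
  H′-uniform S H′S = H-uniform S (∧-conicalˡ _ _ H′S)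

  maximal : ∃₂ λ m (M : Fin m → Subset n) →
    IsMatching H′ M × (∀ {S} → S ∈ˡ allSubsets n → H′ S ≡ true → ¬ S ⊆ ∁ (vertices M))
  maximal = ∃-maximal-matching H′ (λ S H′S → ∣p∣>0⇒Nonempty (subst (0 <_) (sym (H′-uniform S H′S)) (s≤s z≤n)))
                               (allSubsets n)

  m : ℕ
  m = proj₁ maximal
  M : Fin m → Subset n
  M = proj₁ (proj₂ maximal)
  U : Subset n
  U = vertices M

  M-matches-H′ : IsMatching H′ M
  M-matches-H′ = proj₁ (proj₂ (proj₂ maximal))

  M-matching : IsMatching H M
  M-matching = (λ i → ∧-conicalˡ (H (M i)) _ (proj₁ M-matches-H′ i)) , proj₂ M-matches-H′

  H′-meets-U : ∀ S → H′ S ≡ true → ¬ S ⊆ ∁ U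
  H′-meets-U S = proj₂ (proj₂ (proj₂ maximal)) (∈-allSubsets S)

  U⊆∁A : U ⊆ ∁ A
  U⊆∁A = vertices-⊆ (λ i → does-true⇒ (M i ⊆? ∁ A) (∧-conicalʳ (H (M i)) _ (proj₁ M-matches-H′ i)))

  m+a<s : m + a < s
  m+a<s with s ≤? m + a
  ... | no  s≰m+a = ≰⇒> s≰m+a
  ... | yes s≤m+a = contradiction (subst (λ t → HasMatching t H) (m∸n+n≡m (<⇒≤ a<s)) extended) no-matching
    where
    s∸a≤m : s ∸ a ≤ m
    s∸a≤m = subst (s ∸ a ≤_) (m+n∸n≡m m a) (∸-monoˡ-≤ a s≤m+a)
    M₀ : Fin (s ∸ a) → Subset n
    M₀ i = M (inject≤ i s∸a≤m)
    extended : HasMatching (s ∸ a + a) H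
    extended = extend-matching a {M = M₀} (IsMatching-take {H = H} s∸a≤m M-matching) refl
                 (≤-reflexive (m∸n+n≡m (<⇒≤ a<s))) high
                 (⊆∁-sym (vertices-⊆ (λ i → U⊆∁A ∘ ⊆-vertices M (inject≤ i s∸a≤m))))

  #H′ : ℕ
  #H′ = ∑ˢ n (λ S → 𝟙 (H′ S))

  ∣U∣≤r*m : ∣ U ∣ ≤ r * m
  ∣U∣≤r*m = ∣vertices∣≤ r M (λ i → H-uniform (M i) (proj₁ M-matching i))

  #H′≤∣U∣*L : #H′ ≤ ∣ U ∣ * L
  #H′≤∣U∣*L = begin
    #H′                                       ≡⟨ ∑ˢ-cong n meets-U ⟩
    ∑ˢ n (λ S → 𝟙 (H′ S ∧ not (S ⊆ᵇ ∁ U)))    ≤⟨ count-meeting≤ n H′ U L low-on-U ⟩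
    ∣ U ∣ * L                                 ∎
    where
    open ≤-Reasoning
    meets-U : ∀ S → 𝟙 (H′ S) ≡ 𝟙 (H′ S ∧ not (S ⊆ᵇ ∁ U))
    meets-U S with H′ S in H′S
    ... | false = refl
    ... | true rewrite dec-false (S ⊆? ∁ U) (H′-meets-U S H′S) = refl
    low-on-U : ∀ {x} → x ∈ U → ∑ˢ n (λ S → 𝟙 (H′ S ∧ x ∈ᵇ S)) ≤ L
    low-on-U {x} x∈U =
      ≤-trans (∑ˢ-mono n (λ S → 𝟙-∧-mono (x ∈ᵇ S) (∧-conicalˡ (H S) (S ⊆ᵇ ∁ A)))) (low (x∈∁p⇒x∉p (U⊆∁A x∈U)))

  -- An edge through T either meets A (it lies in the star of A) or it is an edge of H′.
  degree-split : ∀ T → degree′ H T ≤ degree′ (star′ r A) T + degree′ H′ T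
  degree-split T = ≤-trans (∑ˢ-mono n pointwise) (≤-reflexive (∑ˢ-distrib-+ n _ _))
    where
    pointwise : ∀ S → 𝟙 (H S ∧ T ⊆ᵇ S)
                    ≤ 𝟙 (((∣ S ∣ ≡ᵇ r) ∧ not (S ⊆ᵇ ∁ A)) ∧ T ⊆ᵇ S) + 𝟙 ((H S ∧ S ⊆ᵇ ∁ A) ∧ T ⊆ᵇ S)
    pointwise S with H S in HS
    ... | false = z≤n
    ... | true rewrite H-uniform S HS | ≡ᵇ-refl r with S ⊆ᵇ ∁ A | T ⊆ᵇ S
    ...   | _     | false = z≤n
    ...   | false | true  = ≤-refl
    ...   | true  | true  = ≤-refl

  K : ℕ
  K = k * D ^ q

  norm-bound : norm′ r k H ≤ norm′ r k (star′ r A) + K * (r * #H′)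
  norm-bound = begin
    norm′ r k H
      ≤⟨ ∑ˢ-mono n pointwise ⟩
    ∑ˢ n (λ T → normTerm (star′ r A) T + K * term H′ T)
      ≡⟨ ∑ˢ-distrib-+ n _ _ ⟩
    norm′ r k (star′ r A) + ∑ˢ n (λ T → K * term H′ T)
      ≡⟨ cong (norm′ r k (star′ r A) +_) (*-distribˡ-∑ˢ n K (term H′)) ⟨
    norm′ r k (star′ r A) + K * ∑ˢ n (term H′)
      ≡⟨ cong (λ x → norm′ r k (star′ r A) + K * x) (handshake (suc p) H′-uniform) ⟩
    norm′ r k (star′ r A) + K * (r * #H′) ∎
    where
    open ≤-Reasoning
    term normTerm : Hypergraph n → Subset n → ℕ
    term     G T = if ∣ T ∣ ≡ᵇ suc p then degree′ G T else 0
    normTerm G T = if ∣ T ∣ ≡ᵇ suc p then degree′ G T ^ k else 0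
    pointwise : ∀ T → normTerm H T ≤ normTerm (star′ r A) T + K * term H′ T
    pointwise T with ∣ T ∣ ≡ᵇ suc p in ∣T∣≡ᵇ1+p
    ... | false = z≤n
    ... | true  = ≤-trans (h^[1+k]≤x^[1+k]+y*[1+k]*D^k q {x = degree′ (star′ r A) T} (degree-split T) degree≤D)
                          (+-monoʳ-≤ _ (≤-reflexive (*-comm (degree′ H′ T) K)))
      where
      ∣T∣≡1+p : ∣ T ∣ ≡ suc p
      ∣T∣≡1+p = ≡ᵇ-true⇒≡ ∣ T ∣ (suc p) ∣T∣≡ᵇ1+p
      degree≤D : degree′ H T ≤ D
      degree≤D = subst (λ t → degree′ H T ≤ n ∸ t) ∣T∣≡1+p (degree′≤ H-uniform T (cong suc ∣T∣≡1+p))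

  module Saturated (a≡s′ : a ≡ s′) where

    ‖star-A‖≡ : norm′ r k (star′ r A) ≡ starNorm n (suc p) k s′
    ‖star-A‖≡ = trans (norm′-star′ n (suc p) k A) (cong (starNorm n (suc p) k) a≡s′)

    m≡0 : m ≡ 0
    m≡0 = n≤0⇒n≡0 (+-cancelʳ-≤ s′ m 0 (≤-pred (subst (λ x → m + x < s) a≡s′ m+a<s)))

    H′-empty : ∀ S → H′ S ≡ false
    H′-empty S with H′ S in H′S
    ... | false = refl
    ... | true  = contradiction (begin
      1           ≡⟨ cong 𝟙 H′S ⟨
      𝟙 (H′ S)    ≤⟨ term≤∑ˢ (𝟙 ∘ H′) S ⟩
      #H′         ≤⟨ #H′≤∣U∣*L ⟩
      ∣ U ∣ * L   ≤⟨ *-monoˡ-≤ L (≤-trans ∣U∣≤r*m (≤-reflexive (cong (r *_) m≡0))) ⟩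
      r * 0 * L   ≡⟨ cong (_* L) (*-zeroʳ r) ⟩
      0           ∎) λ ()
      where open ≤-Reasoning

    H⊆star : ∀ S → H S ≡ true → star′ r A S ≡ true
    H⊆star S HS rewrite H-uniform S HS | ≡ᵇ-refl r | trans (cong (_∧ S ⊆ᵇ ∁ A) (sym HS)) (H′-empty S) = refl

    bound : norm′ r k H ≤ starNorm n (suc p) k s′
    bound = ≤-trans (norm′-mono r k H⊆star) (≤-reflexive ‖star-A‖≡)

    extremal : norm′ r k H ≡ starNorm n (suc p) k s′ → ∀ S → H S ≡ star′ r A S
    extremal ‖H‖≡ S with H S in HS | star′ r A S in starS
    ... | true  | true  = refl
    ... | false | false = refl
    ... | true  | false = contradiction (trans (sym (H⊆star S HS)) starS) λ ()
    ... | false | true  =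
      contradiction (trans ‖H‖≡ (sym ‖star-A‖≡)) (<⇒≢ (norm′-mono-< (suc p) q H⊆star S HS starS ∣S∣≡r))
      where
      ∣S∣≡r : ∣ S ∣ ≡ r
      ∣S∣≡r = ≡ᵇ-true⇒≡ ∣ S ∣ r (∧-conicalˡ _ _ starS)

  module Unsaturated (a<s′ : a < s′) where

    c : ℕ
    c = errorConstant r s

    ≤n : ∀ {x} → x ≤ threshold s k r → x ≤ n
    ≤n x≤n₀ = ≤-trans x≤n₀ (<⇒≤ n-large)

    k*c+s≤D : k * c + s ≤ D
    k*c+s≤D = m+n≤o⇒m≤o∸n (k * c + s) (≤n (+-monoʳ-≤ (k * c + s) (≤-trans (n≤1+n (suc p)) (m≤m+n r _))))

    a≤D : a ≤ D
    a≤D = ≤-trans (<⇒≤ a<s) (≤-trans (m≤n+m s (k * c)) k*c+s≤D)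

    N : ℕ
    N = n ∸ 1 ∸ a

    2p+[1+a]≤n : 2 * p + suc a ≤ n
    2p+[1+a]≤n = ≤n (begin
      2 * p + suc a           ≤⟨ +-mono-≤ (*-monoʳ-≤ 2 (m≤n+m p 2)) a<s ⟩
      2 * r + s               ≡⟨ +-comm (2 * r) s ⟩
      s + 2 * r               ≤⟨ +-monoˡ-≤ (2 * r) (m≤n+m s (k * c)) ⟩
      threshold s k r         ∎)
      where open ≤-Reasoning

    2p≤N : 2 * p ≤ N
    2p≤N = subst (2 * p ≤_) (sym (∸-+-assoc n 1 a)) (m+n≤o⇒m≤o∸n (2 * p) 2p+[1+a]≤n)

    a+N≡n∸1 : a + N ≡ n ∸ 1
    a+N≡n∸1 = m+[n∸m]≡n (m+n≤o⇒m≤o∸n a (subst (_≤ n) (+-comm 1 a) (m+n≤o⇒n≤o (2 * p) 2p+[1+a]≤n)))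

    A′⊇A : ∃ λ A′ → A ⊆ A′ × ∣ A′ ∣ ≡ s′
    A′⊇A = ∃-⊇-of-size A s′ (<⇒≤ a<s′) s′≤n
    A′ : Subset n
    A′ = proj₁ A′⊇A
    A⊆A′ : A ⊆ A′
    A⊆A′ = proj₁ (proj₂ A′⊇A)
    ∣A′∣≡s′ : ∣ A′ ∣ ≡ s′
    ∣A′∣≡s′ = proj₂ (proj₂ A′⊇A)

    b∈A′∖A : ∃ λ b → b ∈ A′ × b ∉ A
    b∈A′∖A = ∃-∈-∖ A⊆A′ (subst (a <_) (sym ∣A′∣≡s′) a<s′)
    b : Fin n
    b = proj₁ b∈A′∖A

    through-b : Subset n → Bool
    through-b T = b ∈ᵇ T ∧ T ⊆ᵇ ∁ A ∧ (∣ T ∣ ≡ᵇ suc p)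

    G : ℕ
    G = ∑ˢ n (𝟙 ∘ through-b)

    G≡NCp : G ≡ N C p
    G≡NCp = begin
      G
        ≡⟨ ∑ˢ-cong n pointwise ⟩
      ∑ˢ n (λ T → 𝟙 (⁅ b ⁆ ⊆ᵇ T ∧ T ⊆ᵇ ∁ A ∧ (∣ T ∣ ≡ᵇ p + ∣ ⁅ b ⁆ ∣)))
        ≡⟨ count-supersets-avoiding n ⁅ b ⁆ A p ⁅b⁆⊆∁A ⟩
      (n ∸ ∣ ⁅ b ⁆ ∣ ∸ a) C p
        ≡⟨ cong (λ x → (n ∸ x ∸ a) C p) (∣⁅x⁆∣≡1 b) ⟩
      N C p ∎
      where
      open ≡-Reasoning
      b∉A : b ∉ A
      b∉A = proj₂ (proj₂ b∈A′∖A)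
      ⁅b⁆⊆∁A : ⁅ b ⁆ ⊆ ∁ A
      ⁅b⁆⊆∁A x∈⁅b⁆ = x∉p⇒x∈∁p (λ x∈A → b∉A (subst (_∈ A) (x∈⁅y⁆⇒x≡y b x∈⁅b⁆) x∈A))
      pointwise : ∀ T → 𝟙 (through-b T) ≡ 𝟙 (⁅ b ⁆ ⊆ᵇ T ∧ T ⊆ᵇ ∁ A ∧ (∣ T ∣ ≡ᵇ p + ∣ ⁅ b ⁆ ∣))
      pointwise T = cong₂ (λ x y → 𝟙 (x ∧ T ⊆ᵇ ∁ A ∧ (∣ T ∣ ≡ᵇ y)))
        (does-≡ (b ∈? T) (⁅ b ⁆ ⊆? T) ∈⇒⁅⁆⊆ (λ ⁅b⁆⊆T → ⁅b⁆⊆T (x∈⁅x⁆ b)))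
        (trans (+-comm 1 p) (cong (p +_) (sym (∣⁅x⁆∣≡1 b))))

    G>0 : 0 < G
    G>0 = subst (0 <_) (sym G≡NCp) (nCk>0 (≤-trans (m≤m+n p (p + 0)) 2p≤N))

    X : ℕ
    X = D ^ k ∸ a ^ k

    -- Adding b to A raises the degree of every (r-1)-set through b avoiding A from a to D.
    gain : norm′ r k (star′ r A) + X * G ≤ norm′ r k (star′ r A′)
    gain = begin
      norm′ r k (star′ r A) + X * G
        ≡⟨ cong (norm′ r k (star′ r A) +_) (*-distribˡ-∑ˢ n X (𝟙 ∘ through-b)) ⟩
      norm′ r k (star′ r A) + ∑ˢ n (λ T → X * 𝟙 (through-b T))
        ≡⟨ ∑ˢ-distrib-+ n _ _ ⟨
      ∑ˢ n (λ T → normTerm A T + X * 𝟙 (through-b T))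
        ≤⟨ ∑ˢ-mono n pointwise ⟩
      norm′ r k (star′ r A′) ∎
      where
      open ≤-Reasoning
      normTerm : Subset n → Subset n → ℕ
      normTerm B T = if ∣ T ∣ ≡ᵇ suc p then degree′ (star′ r B) T ^ k else 0
      pointwise : ∀ T → normTerm A T + X * 𝟙 (through-b T) ≤ normTerm A′ T
      pointwise T with through-b T in T-through-b
      ... | false = begin
        normTerm A T + X * 0 ≡⟨ trans (cong (normTerm A T +_) (*-zeroʳ X)) (+-identityʳ _) ⟩
        normTerm A T         ≤⟨ if-0-mono (∣ T ∣ ≡ᵇ suc p) (^-monoˡ-≤ k (degree′-mono (star′-mono r A⊆A′) T)) ⟩
        normTerm A′ T        ∎
      ... | true = subst (λ c → (if c then degree′ (star′ r A) T ^ k else 0) + X * 1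
                                  ≤ (if c then degree′ (star′ r A′) T ^ k else 0))
                         (sym ∣T∣≡ᵇ1+p) (≤-reflexive (begin-equality
        degree′ (star′ r A) T ^ k + X * 1  ≡⟨ cong₂ (λ x y → x ^ k + y) (degree′-star′-avoiding A T ∣T∣+1≡r T⊆∁A)
                                                                         (*-identityʳ X) ⟩
        a ^ k + X                          ≡⟨ m+[n∸m]≡n (^-monoˡ-≤ k a≤D) ⟩
        D ^ k                              ≡⟨ cong (λ x → (n ∸ x) ^ k) ∣T∣≡1+p ⟨
        (n ∸ ∣ T ∣) ^ k                    ≡⟨ cong (_^ k) (degree′-star′-meeting A′ T ∣T∣+1≡r T⊈∁A′) ⟨
        degree′ (star′ r A′) T ^ k         ∎))
        where
        b∈T : b ∈ T
        b∈T = does-true⇒ (b ∈? T) (∧-conicalˡ (b ∈ᵇ T) _ T-through-b)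
        rest : (T ⊆ᵇ ∁ A ∧ (∣ T ∣ ≡ᵇ suc p)) ≡ true
        rest = ∧-conicalʳ (b ∈ᵇ T) (T ⊆ᵇ ∁ A ∧ (∣ T ∣ ≡ᵇ suc p)) T-through-b
        T⊆∁A : T ⊆ ∁ A
        T⊆∁A = does-true⇒ (T ⊆? ∁ A) (∧-conicalˡ (T ⊆ᵇ ∁ A) _ rest)
        ∣T∣≡ᵇ1+p : (∣ T ∣ ≡ᵇ suc p) ≡ true
        ∣T∣≡ᵇ1+p = ∧-conicalʳ (T ⊆ᵇ ∁ A) (∣ T ∣ ≡ᵇ suc p) rest
        ∣T∣≡1+p : ∣ T ∣ ≡ suc p
        ∣T∣≡1+p = ≡ᵇ-true⇒≡ ∣ T ∣ (suc p) ∣T∣≡ᵇ1+p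
        ∣T∣+1≡r : suc ∣ T ∣ ≡ r
        ∣T∣+1≡r = cong suc ∣T∣≡1+p
        T⊈∁A′ : ¬ T ⊆ ∁ A′
        T⊈∁A′ T⊆∁A′ = x∈∁p⇒x∉p (T⊆∁A′ b∈T) (proj₁ (proj₂ b∈A′∖A))

    Q≤2^s*G : Q ≤ 2 ^ s * G
    Q≤2^s*G = begin
      (n ∸ 2) C p       ≤⟨ nCk-monoˡ p (∸-monoʳ-≤ n (s≤s z≤n)) ⟩
      (n ∸ 1) C p       ≡⟨ cong (_C p) a+N≡n∸1 ⟨
      (a + N) C p       ≤⟨ [j+n]Ck≤2^j*nCk N a p (≤-trans 2p≤N (n≤1+n N)) ⟩
      2 ^ a * (N C p)   ≤⟨ *-monoˡ-≤ (N C p) (^-monoʳ-≤ 2 (<⇒≤ a<s)) ⟩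
      2 ^ s * (N C p)   ≡⟨ cong (2 ^ s *_) G≡NCp ⟨
      2 ^ s * G         ∎
      where open ≤-Reasoning

    r*#H′≤c*G : r * #H′ ≤ c * G
    r*#H′≤c*G = begin
      r * #H′                                 ≤⟨ *-monoʳ-≤ r #H′≤∣U∣*L ⟩
      r * (∣ U ∣ * L)                          ≤⟨ *-monoʳ-≤ r (*-monoˡ-≤ L (≤-trans ∣U∣≤r*m (*-monoʳ-≤ r m≤s))) ⟩
      r * (r * s * (r * s * Q))               ≤⟨ *-monoʳ-≤ r (*-monoʳ-≤ (r * s) (*-monoʳ-≤ (r * s) Q≤2^s*G)) ⟩
      r * (r * s * (r * s * (2 ^ s * G)))     ≡⟨ solve 4 (λ r s t G → r :* (r :* s :* (r :* s :* (t :* G)))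
                                                                 := r :* (r :* s :* (r :* s :* t)) :* G)
                                                       refl r s (2 ^ s) G ⟩
      c * G                                   ∎
      where
      open ≤-Reasoning
      m≤s : m ≤ s
      m≤s = ≤-trans (m≤m+n m a) (<⇒≤ m+a<s)

    K*c<X : K * c < X
    K*c<X = m+n≤o⇒m≤o∸n (suc (K * c)) (begin-strict
      K * c + a ^ k        ≤⟨ +-monoʳ-≤ (K * c) (*-monoʳ-≤ a (^-monoˡ-≤ q a≤D)) ⟩
      K * c + a * D ^ q    <⟨ +-monoʳ-< (K * c) (<-≤-trans (m<n+m (a * D ^ q) D^q>0) (*-monoˡ-≤ (D ^ q) a<s)) ⟩
      K * c + s * D ^ q    ≡⟨ solve 4 (λ k Dq c s → k :* Dq :* c :+ s :* Dq := (k :* c :+ s) :* Dq)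
                                    refl k (D ^ q) c s ⟩
      (k * c + s) * D ^ q  ≤⟨ *-monoˡ-≤ (D ^ q) k*c+s≤D ⟩
      D ^ k                ∎)
      where
      open ≤-Reasoning
      D^q>0 : 0 < D ^ q
      D^q>0 = m^n>0 D {{>-nonZero (≤-trans (s≤s z≤n) (≤-trans (m≤n+m s (k * c)) k*c+s≤D))}} q

    strict : norm′ r k H < starNorm n (suc p) k s′
    strict = begin-strict
      norm′ r k H                             ≤⟨ norm-bound ⟩
      norm′ r k (star′ r A) + K * (r * #H′)   ≤⟨ +-monoʳ-≤ _ (*-monoʳ-≤ K r*#H′≤c*G) ⟩
      norm′ r k (star′ r A) + K * (c * G)     ≡⟨ cong (norm′ r k (star′ r A) +_) (*-assoc K c G) ⟨
      norm′ r k (star′ r A) + K * c * G       <⟨ +-monoʳ-< _ (*-monoˡ-< G {{>-nonZero G>0}} K*c<X) ⟩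
      norm′ r k (star′ r A) + X * G           ≤⟨ gain ⟩
      norm′ r k (star′ r A′)                  ≡⟨ norm′-star′ n (suc p) k A′ ⟩
      starNorm n (suc p) k ∣ A′ ∣              ≡⟨ cong (starNorm n (suc p) k) ∣A′∣≡s′ ⟩
      starNorm n (suc p) k s′                 ∎
      where open ≤-Reasoning

  norm≤starNorm : norm′ r k H ≤ starNorm n (suc p) k s′
  norm≤starNorm with m≤n⇒m<n∨m≡n (≤-pred a<s)
  ... | inj₁ a<s′ = <⇒≤ (Unsaturated.strict a<s′)
  ... | inj₂ a≡s′ = Saturated.bound a≡s′

  extremal : norm′ r k H ≡ starNorm n (suc p) k s′ → ∃ λ A₀ → ∣ A₀ ∣ ≡ s′ × (∀ S → H S ≡ star′ r A₀ S)
  extremal ‖H‖≡ with m≤n⇒m<n∨m≡n (≤-pred a<s)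
  ... | inj₁ a<s′ = contradiction ‖H‖≡ (<⇒≢ (Unsaturated.strict a<s′))
  ... | inj₂ a≡s′ = A , a≡s′ , Saturated.extremal a≡s′ ‖H‖≡

  ‖star-initSeg‖≡ : norm r k (star r (initSeg {n} s)) ≡ starNorm n (suc p) k s′
  ‖star-initSeg‖≡ = trans (norm-star (suc p) k (initSeg {n} s)) (cong (starNorm n (suc p) k) (∣initSeg∣ s′ s′≤n))

  norm≤norm-star : norm r k H ≤ norm r k (star r (initSeg {n} s))
  norm≤norm-star = subst₂ _≤_ (sym (norm≡norm′ r k H)) (sym ‖star-initSeg‖≡) norm≤starNorm

  IsStar : ℕ → Set
  IsStar c = Σ (Subset n) (λ A₀ → (∣ A₀ ∣ ≡ c) × (∀ S → H S ≡ star r A₀ S))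

  norm≡norm-star⇔star : norm r k H ≡ norm r k (star r (initSeg {n} s)) ⇔ IsStar s′
  norm≡norm-star⇔star = mk⇔ only-if if′
    where
    only-if : norm r k H ≡ norm r k (star r (initSeg {n} s)) → IsStar s′
    only-if ‖H‖≡‖star‖ =
      let A₀ , ∣A₀∣≡s′ , H≗star′ = extremal (trans (sym (norm≡norm′ r k H)) (trans ‖H‖≡‖star‖ ‖star-initSeg‖≡))
      in A₀ , ∣A₀∣≡s′ , λ S → trans (H≗star′ S) (sym (star≡star′ r A₀ S))
    if′ : IsStar s′ → norm r k H ≡ norm r k (star r (initSeg {n} s))
    if′ (A₀ , ∣A₀∣≡s′ , H≗star) = begin
      norm r k H                        ≡⟨ norm-cong r k H≗star ⟩
      norm r k (star r A₀)              ≡⟨ norm-star (suc p) k A₀ ⟩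
      starNorm n (suc p) k ∣ A₀ ∣        ≡⟨ cong (starNorm n (suc p) k) ∣A₀∣≡s′ ⟩
      starNorm n (suc p) k s′           ≡⟨ ‖star-initSeg‖≡ ⟨
      norm r k (star r (initSeg {n} s)) ∎
      where open ≡-Reasoning

theorem1p5 : ∀ (s k r : ℕ) → 1 ≤ s → 2 ≤ k → 2 ≤ r →
    ∃ λ (n₀ : ℕ) → ∀ (n : ℕ) → n₀ < n →
      ∀ (H : Hypergraph n) → Uniform r H → ¬ HasMatching s H →
        (norm r k H ≤ norm r k (star r (initSeg {n} s)))
        × (norm r k H ≡ norm r k (star r (initSeg {n} s))
           ⇔ Σ (Subset n) (λ A → (∣ A ∣ ≡ s ∸ 1) × (∀ S → H S ≡ star r A S)))
theorem1p5 zero    _       _             () _  _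
theorem1p5 _       zero    _             _  () _
theorem1p5 _       _       zero          _  _  ()
theorem1p5 _       _       (suc zero)    _  _  (s≤s ())
theorem1p5 (suc s′) (suc q) (suc (suc p)) _ _ _ =
  threshold (suc s′) (suc q) (2 + p) , λ n n₀<n H H-uniform no-matching →
    let open StarBound s′ q p n₀<n H H-uniform no-matching in norm≤norm-star , norm≡norm-star⇔star
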